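{- Let $k\geq 1$ and $n\geq k+2$ be integers. Then the $k$-distance matrices of all $k$-trees with $n$ vertices are equivalent over $\mathbb{Z}$: if $T$ and $T'$ are $k$-trees with $n$ vertices, there exist square integer matrices ${\sf P},{\sf Q}$ with determinant $\pm1$ such that ${\sf D}^k(T)={\sf P}\,{\sf D}^k(T')\,{\sf Q}$.
   Context: A $k$-clique is a complete subgraph on $k$ vertices. A $k$-tree is either the complete graph on $k$ vertices or a graph obtained from a smaller $k$-tree by adjoining a new vertex together with $k$ edges joining it to all vertices of some $k$-clique. In a $k$-tree $T$, a $k$-walk between $k$-cliques $\tau,\tau'$ is a sequence $\tau_1\sigma_1\tau_2\sigma_2\cdots\tau_l$ with $\tau_1=\tau$, $\tau_l=\tau'$, where $\tau_i,\tau_{i+1}$ are $k$-cliques both contained in the $(k+1)$-clique $\sigma_i$. The $k$-distance $\operatorname{dist}^k(\tau,\tau')$ is the number of $(k+1)$-cliques in a shortest $k$-walk from $\tau$ to $\tau'$ (and $0$ if $\tau=\tau'$). If $\tau_1,\dots,\tau_{c}$ are the $k$-cliques of $T$ (in some order), the $k$-distance matrix ${\sf D}^k(T)$ is the $c\times c$ matrix with $(i,j)$-entry $\operatorname{dist}^k(\tau_i,\tau_j)$. (A $k$-tree with $n\ge k$ vertices has $k(n-k)+1$ $k$-cliques.) -}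

module Defs where

open import Data.Nat using (ℕ; zero; suc; _≤_)
open import Data.Bool using (Bool; true; false; not)
open import Data.Fin using (Fin; zero; suc; punchIn; _≟_)
open import Data.Fin.Subset using (Subset; _∈_; _⊆_; ∣_∣)
open import Data.Vec using (lookup)
open import Data.Integer as ℤ using (ℤ; +_; -_)
open import Data.Product using (Σ; ∃; _×_; _,_)
open import Data.Sum using (_⊎_)
open import Relation.Nullary using (¬_)
open import Relation.Nullary.Decidable using (⌊_⌋)
open import Relation.Binary.PropositionalEquality using (_≡_; _≢_)

Graph : ℕ → Set
Graph n = Fin n → Fin n → Bool

IsClique : ∀ {n} → Graph n → Subset n → Set
IsClique G s = ∀ i j → i ∈ s → j ∈ s → i ≢ j → G i j ≡ true

IsKClique : ∀ {n} → ℕ → Graph n → Subset n → Set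
IsKClique k G s = ∣ s ∣ ≡ k × IsClique G s

-- k-trees (inductive definition). The new vertex may receive any label p;
-- the old vertices are relabelled by punchIn p.

data KTree (k : ℕ) : (n : ℕ) → Graph n → Set where
  base : (G : Graph k) →
         (∀ i j → G i j ≡ not ⌊ i ≟ j ⌋) →
         KTree k k G
  step : ∀ {m} {H : Graph m} → KTree k m H →
         (C : Subset m) → IsKClique k H C →
         (p : Fin (suc m)) (G : Graph (suc m)) →
         (∀ i j → G (punchIn p i) (punchIn p j) ≡ H i j) →
         (∀ i → G p (punchIn p i) ≡ lookup C i) →
         (∀ i → G (punchIn p i) p ≡ lookup C i) →
         G p p ≡ false →
         KTree k (suc m) G

-- k-walks and k-distance.
-- KWalk k G τ τ' l : there is a k-walk τ = τ₁ σ₁ τ₂ … σ_l τ_{l+1} = τ'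
-- using l (k+1)-cliques σ_i, with τ_i, τ_{i+1} k-cliques contained in σ_i.

data KWalk {n} (k : ℕ) (G : Graph n) : Subset n → Subset n → ℕ → Set where
  nil  : ∀ {τ} → KWalk k G τ τ 0
  cons : ∀ {τ τ₂ τ' l} (σ : Subset n) →
         IsKClique (suc k) G σ →
         IsKClique k G τ → IsKClique k G τ₂ →
         τ ⊆ σ → τ₂ ⊆ σ →
         KWalk k G τ₂ τ' l →
         KWalk k G τ τ' (suc l)

IsKDist : ∀ {n} → ℕ → Graph n → Subset n → Subset n → ℕ → Set
IsKDist k G τ τ' d = KWalk k G τ τ' d × (∀ l → KWalk k G τ τ' l → d ≤ l)

IsKCliqueEnumeration : ∀ {n} → ℕ → Graph n → (c : ℕ) → (Fin c → Subset n) → Set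
IsKCliqueEnumeration k G c e =
  (∀ i → IsKClique k G (e i)) ×
  (∀ i j → e i ≡ e j → i ≡ j) ×
  (∀ s → IsKClique k G s → ∃ λ i → e i ≡ s)

Matrix : ℕ → Set
Matrix c = Fin c → Fin c → ℤ

sumFin : ∀ {c} → (Fin c → ℤ) → ℤ
sumFin {zero}  f = + 0
sumFin {suc c} f = f zero ℤ.+ sumFin (λ i → f (suc i))

_⊗_ : ∀ {c} → Matrix c → Matrix c → Matrix c
(A ⊗ B) i j = sumFin (λ l → A i l ℤ.* B l j)

sign : ℕ → ℤ
sign zero    = + 1
sign (suc m) = - sign m

det : ∀ {c} → Matrix c → ℤ
det {zero}  M = + 1
det {suc c} M = sumFin (λ j → sign (Data.Fin.toℕ j) ℤ.* (M zero j ℤ.* det (λ a b → M (suc a) (punchIn j b))))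

Unimodular : ∀ {c} → Matrix c → Set
Unimodular M = det M ≡ + 1 ⊎ det M ≡ - (+ 1)

{-# OPTIONS --safe #-}
-- Along the construction of a k-tree with k + s vertices, its k-cliques can be enumerated so that
-- P D Pᵀ = M_s for an integer matrix P invertible over ℤ and a matrix M_s depending only on k and s.
-- Adjoining a vertex p to the k-clique C creates the k-cliques ν_x = (C ∪ {p}) ∖ {x} for x ∈ C,
-- with d(ν_x, τ) = 1 + d(C, τ) for every old τ and d(ν_x, ν_y) = 1 for x ≠ y. Subtracting the row
-- and column of C from those of every ν_x therefore leaves the old block, constant blocks of ones,
-- and -J - I; conjugating by P turns the ones into e₀ 1ᵀ as long as every row of P sums to e₀,
-- an invariant the new P keeps. So the k-distance matrices of any two k-trees on n vertices are
-- congruent to the same M_(n-k), and the transforming matrices are unimodular because the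
-- determinant is multiplicative.
module Submission where

open import Defs

open import Data.Nat as ℕ using (ℕ; zero; suc)
open import Data.Fin as Fin using (Fin; zero; suc; punchIn; punchOut; toℕ; _↑ˡ_; _↑ʳ_)
open import Data.Fin.Properties as FinP using (punchInᵢ≢i; punchIn-punchOut; punchOut-punchIn; punchOut-cong; any?)
open import Data.Integer as ℤ using (ℤ; +_; -_; _+_; _-_; _*_)
import Data.Integer.Properties as ℤP
import Data.Nat.Properties as ℕP
open import Data.Integer.Tactic.RingSolver using (solve-∀)
open import Algebra.Properties.Semiring.Sum ℤP.+-*-semiring
  using (sum; sum-cong-≗; sum-replicate-zero; ∑-distrib-+; ∑-comm; sum-remove; *-distribˡ-sum; *-distribʳ-sum)
open import Data.Empty using (⊥; ⊥-elim)
open import Data.Sum using (_⊎_; inj₁; inj₂)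
open import Data.Product using (∃; ∃₂; _×_; _,_; proj₁; proj₂)
import Data.Product
open import Data.Bool using (true; false; not)
open import Data.Vec using (lookup)
open import Data.Fin.Subset using (Subset; _∈_; _∉_; _⊆_; ∣_∣; ⊤)
open import Data.Fin.Subset.Properties using (∣⊤∣≡n; ∣p∣≡n⇒p≡⊤)
open import Function using (_∘_; id)
open import Relation.Nullary using (yes; no)
open import Relation.Nullary.Decidable using (⌊_⌋)
open import Relation.Binary.PropositionalEquality

open ≡-Reasoning

sumFin≡sum : ∀ {c} (f : Fin c → ℤ) → sumFin f ≡ sum f
sumFin≡sum {zero}  f = refl
sumFin≡sum {suc c} f = cong (_+_ (f zero)) (sumFin≡sum (f ∘ suc))

sum-zero : ∀ {c} {f : Fin c → ℤ} → (∀ i → f i ≡ + 0) → sum f ≡ + 0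
sum-zero {c} h = trans (sum-cong-≗ h) (sum-replicate-zero c)

sum-*ˡ : ∀ {c} a (f : Fin c → ℤ) → sum (λ i → a * f i) ≡ a * sum f
sum-*ˡ a f = sym (*-distribˡ-sum a f)

sum-*ʳ : ∀ {c} a (f : Fin c → ℤ) → sum (λ i → f i * a) ≡ sum f * a
sum-*ʳ a f = sym (*-distribʳ-sum a f)

sum-neg : ∀ {c} (f : Fin c → ℤ) → sum (λ i → - f i) ≡ - sum f
sum-neg f = begin
  sum (λ i → - f i)        ≡⟨ sum-cong-≗ (λ i → sym (ℤP.-1*i≡-i (f i))) ⟩
  sum (λ i → - + 1 * f i)  ≡⟨ sum-*ˡ (- + 1) f ⟩
  - + 1 * sum f            ≡⟨ ℤP.-1*i≡-i (sum f) ⟩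
  - sum f                  ∎

sum-linear : ∀ {c} x y (f g : Fin c → ℤ) → sum (λ i → x * f i + y * g i) ≡ x * sum f + y * sum g
sum-linear x y f g = trans (∑-distrib-+ (λ i → x * f i) (λ i → y * g i)) (cong₂ _+_ (sum-*ˡ x f) (sum-*ˡ y g))

sum-↑ : ∀ {a b} (f : Fin (a ℕ.+ b) → ℤ) → sum f ≡ sum (λ i → f (i ↑ˡ b)) + sum (λ j → f (a ↑ʳ j))
sum-↑ {zero}  f = sym (ℤP.+-identityˡ _)
sum-↑ {suc a} {b} f = trans (cong (_+_ (f zero)) (sum-↑ {a} {b} (f ∘ suc))) (sym (ℤP.+-assoc (f zero) _ _))

δ : ∀ {c} → Fin c → Fin c → ℤ
δ zero    zero    = + 1
δ zero    (suc _) = + 0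
δ (suc _) zero    = + 0
δ (suc i) (suc j) = δ i j

δ-sym : ∀ {c} (i j : Fin c) → δ i j ≡ δ j i
δ-sym zero    zero    = refl
δ-sym zero    (suc j) = refl
δ-sym (suc i) zero    = refl
δ-sym (suc i) (suc j) = δ-sym i j

δ-refl : ∀ {c} (i : Fin c) → δ i i ≡ + 1
δ-refl zero    = refl
δ-refl (suc i) = δ-refl i

δ-≢ : ∀ {c} {i j : Fin c} → i ≢ j → δ i j ≡ + 0
δ-≢ {i = zero}  {zero}  i≢j = ⊥-elim (i≢j refl)
δ-≢ {i = zero}  {suc j} i≢j = refl
δ-≢ {i = suc i} {zero}  i≢j = refl
δ-≢ {i = suc i} {suc j} i≢j = δ-≢ (i≢j ∘ cong suc)

δ-punchIn : ∀ {c} (j : Fin (suc c)) b b' → δ (punchIn j b) (punchIn j b') ≡ δ b b'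
δ-punchIn zero    b       b'       = refl
δ-punchIn (suc j) zero    zero     = refl
δ-punchIn (suc j) zero    (suc b') = refl
δ-punchIn (suc j) (suc b) zero     = refl
δ-punchIn (suc j) (suc b) (suc b') = δ-punchIn j b b'

punchIn-elim : ∀ {c} (j : Fin (suc c)) (P : Fin (suc c) → Set) → P j → (∀ b → P (punchIn j b)) → ∀ l → P l
punchIn-elim j P Pj Pp l with j Fin.≟ l
... | yes refl = Pj
... | no j≢l   = subst P (punchIn-punchOut j≢l) (Pp (punchOut j≢l))

sum-δˡ : ∀ {c} (j : Fin c) (f : Fin c → ℤ) → sum (λ i → δ j i * f i) ≡ f j
sum-δˡ zero    f = trans (cong₂ _+_ (ℤP.*-identityˡ (f zero)) (sum-zero {f = λ i → + 0 * f (suc i)} (λ _ → refl)))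
                         (ℤP.+-identityʳ _)
sum-δˡ (suc j) f = trans (ℤP.+-identityˡ _) (sum-δˡ j (f ∘ suc))

sum-δʳ : ∀ {c} (j : Fin c) (f : Fin c → ℤ) → sum (λ i → f i * δ i j) ≡ f j
sum-δʳ j f = trans (sum-cong-≗ (λ i → trans (ℤP.*-comm (f i) _) (cong (_* f i) (δ-sym i j)))) (sum-δˡ j f)

sum-neg-δ : ∀ {c} (j : Fin c) (f : Fin c → ℤ) → sum (λ i → - δ j i * f i) ≡ - f j
sum-neg-δ j f = begin
  sum (λ i → - δ j i * f i)    ≡⟨ sum-cong-≗ (λ i → ℤP.neg-distribˡ-* (δ j i) (f i)) ⟨
  sum (λ i → - (δ j i * f i))  ≡⟨ sum-neg (λ i → δ j i * f i) ⟩
  - sum (λ i → δ j i * f i)    ≡⟨ cong -_ (sum-δˡ j f) ⟩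
  - f j                        ∎

sum-δ : ∀ {c} (j : Fin c) → sum (δ j) ≡ + 1
sum-δ j = trans (sum-cong-≗ (λ i → sym (ℤP.*-identityʳ (δ j i)))) (sum-δˡ j (λ _ → + 1))

Mat : ℕ → ℕ → Set
Mat a b = Fin a → Fin b → ℤ

infixl 7 _·_
_·_ : ∀ {a b c} → Mat a b → Mat b c → Mat a c
(A · B) i j = sum (λ l → A i l * B l j)

infix 4 _≐_
_≐_ : ∀ {a b} → Mat a b → Mat a b → Set
A ≐ B = ∀ i j → A i j ≡ B i j

_ᵀ : ∀ {a b} → Mat a b → Mat b a
(A ᵀ) i j = A j i

·-cong : ∀ {a b c} {A A' : Mat a b} {B B' : Mat b c} → A ≐ A' → B ≐ B' → A · B ≐ A' · B'
·-cong A≐A' B≐B' i j = sum-cong-≗ (λ l → cong₂ _*_ (A≐A' i l) (B≐B' l j))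

·-congˡ : ∀ {a b c} (A : Mat a b) {B B' : Mat b c} → B ≐ B' → A · B ≐ A · B'
·-congˡ A = ·-cong {A = A} (λ i j → refl)

·-congʳ : ∀ {a b c} {A A' : Mat a b} (B : Mat b c) → A ≐ A' → A · B ≐ A' · B
·-congʳ B A≐A' = ·-cong {B = B} A≐A' (λ i j → refl)

·-assoc : ∀ {a b c d} (A : Mat a b) (B : Mat b c) (C : Mat c d) → (A · B) · C ≐ A · (B · C)
·-assoc A B C i j = begin
  sum (λ l → sum (λ m → A i m * B m l) * C l j)  ≡⟨ sum-cong-≗ (λ l → sym (sum-*ʳ (C l j) (λ m → A i m * B m l))) ⟩
  sum (λ l → sum (λ m → A i m * B m l * C l j))  ≡⟨ ∑-comm (λ l m → A i m * B m l * C l j) ⟩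
  sum (λ m → sum (λ l → A i m * B m l * C l j))  ≡⟨ sum-cong-≗ (λ m → trans
                                                       (sum-cong-≗ (λ l → ℤP.*-assoc (A i m) (B m l) (C l j)))
                                                       (sum-*ˡ (A i m) (λ l → B m l * C l j))) ⟩
  sum (λ m → A i m * sum (λ l → B m l * C l j))  ∎

·-identityˡ : ∀ {a b} (A : Mat a b) → δ · A ≐ A
·-identityˡ A i j = sum-δˡ i (λ l → A l j)

·-identityʳ : ∀ {a b} (A : Mat a b) → A · δ ≐ A
·-identityʳ A i j = sum-δʳ j (A i)

ᵀ-· : ∀ {a b c} (A : Mat a b) (B : Mat b c) → (A · B) ᵀ ≐ B ᵀ · A ᵀ
ᵀ-· A B i j = sum-cong-≗ (λ l → ℤP.*-comm (A j l) (B l i))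

ᵀ-inverse : ∀ {a b} {A : Mat a b} {B : Mat b a} → A · B ≐ δ → B ᵀ · A ᵀ ≐ δ
ᵀ-inverse {A = A} {B} AB≐δ i j = trans (sym (ᵀ-· A B i j)) (trans (AB≐δ j i) (δ-sym j i))

-- Determinants

module Determinant where

  open import Data.Vec.Functional using (_∷_; map; updateAt; insertAt)
  open import Algebra.Properties.AbelianGroup ℤP.+-0-abelianGroup using (inverseʳ-unique)
  open import Data.Vec.Functional.Properties
    using (updateAt-updates; updateAt-minimal; updateAt-commutes; updateAt-id-local; map-updateAt-local;
           insertAt-lookup; insertAt-punchIn)

  sgn : ∀ {c} → Fin c → ℤ
  sgn j = sign (toℕ j)

  minor : ∀ {c} → Matrix (suc c) → Fin (suc c) → Matrix c
  minor M j a b = M (suc a) (punchIn j b)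

  det-expand : ∀ {c} (M : Matrix (suc c)) → det M ≡ sum (λ j → sgn j * (M zero j * det (minor M j)))
  det-expand M = sumFin≡sum (λ j → sgn j * (M zero j * det (minor M j)))

  det-cong : ∀ {c} {A B : Matrix c} → A ≐ B → det A ≡ det B
  det-cong {zero}  A≐B = refl
  det-cong {suc c} {A} {B} A≐B = begin
    det A                                              ≡⟨ det-expand A ⟩
    sum (λ j → sgn j * (A zero j * det (minor A j)))   ≡⟨ sum-cong-≗ (λ j → cong₂ (λ x d → sgn j * (x * d))
                                                            (A≐B zero j) (det-cong (λ a b → A≐B (suc a) (punchIn j b)))) ⟩
    sum (λ j → sgn j * (B zero j * det (minor B j)))   ≡⟨ det-expand B ⟨
    det B                                              ∎

  setRow : ∀ {a b} → Mat a b → Fin a → (Fin b → ℤ) → Mat a b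
  setRow N r w = updateAt N r (λ _ → w)

  setRow-row : ∀ {a b} (N : Mat a b) r w → setRow N r w r ≡ w
  setRow-row N r w = updateAt-updates r N

  setRow-other : ∀ {a b} (N : Mat a b) r w {i} → i ≢ r → setRow N r w i ≡ N i
  setRow-other N r w {i} i≢r = updateAt-minimal i r N i≢r

  setRow-unique : ∀ {a b} {N X : Mat a b} r {w} → X r ≗ w → (∀ i → i ≢ r → X i ≗ N i) → setRow N r w ≐ X
  setRow-unique {N = N} r {w} Xr≗w others i l with i Fin.≟ r
  ... | yes refl = trans (cong-app (setRow-row N r w) l) (sym (Xr≗w l))
  ... | no i≢r   = trans (cong-app (setRow-other N r w i≢r) l) (sym (others i i≢r l))

  setRow-cong : ∀ {a b} (N : Mat a b) r {w w'} → w ≗ w' → setRow N r w ≐ setRow N r w'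
  setRow-cong N r {w} {w'} w≗w' = setRow-unique r
    (λ l → trans (cong-app (setRow-row N r w') l) (sym (w≗w' l)))
    (λ i i≢r l → cong-app (setRow-other N r w' i≢r) l)

  setRow-map : ∀ {a b b'} (h : (Fin b → ℤ) → (Fin b' → ℤ)) (N : Mat a b) r w →
               map h (setRow N r w) ≗ setRow (map h N) r (h w)
  setRow-map h N r w = map-updateAt-local {f = h} N r refl

  setRow-comm : ∀ {a b} (N : Mat a b) {r r'} → r ≢ r' → ∀ y z →
                setRow (setRow N r y) r' z ≐ setRow (setRow N r' z) r y
  setRow-comm N {r} {r'} r≢r' y z i = cong-app (updateAt-commutes r' r (r≢r' ∘ sym) N i)

  swapRows : ∀ {a b} → Mat a b → Fin a → Fin a → Mat a b
  swapRows N r r' = setRow (setRow N r (N r')) r' (N r)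

  Extensional : ∀ {a b} → (Mat a b → ℤ) → Set
  Extensional f = ∀ {A B} → A ≐ B → f A ≡ f B

  RowLinear : ∀ {a b} → (Mat a b → ℤ) → Set
  RowLinear {b = b} f = ∀ N r (u v : Fin b → ℤ) x y →
    f (setRow N r (λ l → x * u l + y * v l)) ≡ x * f (setRow N r u) + y * f (setRow N r v)

  Alternating : ∀ {a b} → (Mat a b → ℤ) → Set
  Alternating f = ∀ N {r r'} → r ≢ r' → N r ≗ N r' → f N ≡ + 0

  record IsMultilinear {a b} (f : Mat a b → ℤ) : Set where
    field
      extensional : Extensional f
      linear      : RowLinear f

    additive : ∀ N r u v → f (setRow N r (λ l → u l + v l)) ≡ f (setRow N r u) + f (setRow N r v)
    additive N r u v = begin
      f (setRow N r (λ l → u l + v l))                 ≡⟨ extensional (setRow-cong N r (λ l →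
                                                            sym (cong₂ _+_ (ℤP.*-identityˡ (u l)) (ℤP.*-identityˡ (v l))))) ⟩
      f (setRow N r (λ l → + 1 * u l + + 1 * v l))     ≡⟨ linear N r u v (+ 1) (+ 1) ⟩
      + 1 * f (setRow N r u) + + 1 * f (setRow N r v)  ≡⟨ cong₂ _+_ (ℤP.*-identityˡ (f (setRow N r u)))
                                                                     (ℤP.*-identityˡ (f (setRow N r v))) ⟩
      f (setRow N r u) + f (setRow N r v)              ∎

  record IsAlternating {a b} (f : Mat a b → ℤ) : Set where
    field
      isMultilinear : IsMultilinear f
      alternating   : Alternating f

    open IsMultilinear isMultilinear public

  swapRows-negates : ∀ {a b} {f : Mat a b → ℤ} → IsAlternating f →
                     ∀ N {r r'} → r ≢ r' → f (swapRows N r r') ≡ - f N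
  swapRows-negates {b = b} {f = f} alt N {r} {r'} r≢r' = cancel (begin
    + 0                                   ≡⟨ g-diag (λ l → u l + v l) ⟨
    g (λ l → u l + v l) (λ l → u l + v l) ≡⟨ g-additiveˡ u v _ ⟩
    g u (λ l → u l + v l) + g v (λ l → u l + v l)
                                          ≡⟨ cong₂ _+_ (additive (setRow N r u) r' u v) (additive (setRow N r v) r' u v) ⟩
    (g u u + g u v) + (g v u + g v v)     ≡⟨ cong₂ _+_ (cong₂ _+_ (g-diag u) g-self) (cong (_+_ (g v u)) (g-diag v)) ⟩
    (+ 0 + f N) + (g v u + + 0)           ∎)
    where
    open IsAlternating alt
    u = N r
    v = N r'
    g : (Fin b → ℤ) → (Fin b → ℤ) → ℤ
    g y z = f (setRow (setRow N r y) r' z)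
    g-diag : ∀ w → g w w ≡ + 0
    g-diag w = alternating _ r≢r' (λ l → trans (cong-app (setRow-other _ r' w r≢r') l)
                                       (trans (cong-app (setRow-row N r w) l) (sym (cong-app (setRow-row _ r' w) l))))
    g-additiveˡ : ∀ y y' z → g (λ l → y l + y' l) z ≡ g y z + g y' z
    g-additiveˡ y y' z = begin
      g (λ l → y l + y' l) z                                ≡⟨ extensional (setRow-comm N r≢r' _ z) ⟩
      f (setRow (setRow N r' z) r (λ l → y l + y' l))       ≡⟨ additive (setRow N r' z) r y y' ⟩
      f (setRow (setRow N r' z) r y) + f (setRow (setRow N r' z) r y')
                                                            ≡⟨ cong₂ _+_ (extensional (setRow-comm N (r≢r' ∘ sym) z y))
                                                                         (extensional (setRow-comm N (r≢r' ∘ sym) z y')) ⟩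
      g y z + g y' z                                        ∎
    g-self : g u v ≡ f N
    g-self = extensional λ i l → trans
      (cong-app (updateAt-id-local r' (setRow N r u) (sym (updateAt-id-local r N refl r')) i) l)
      (cong-app (updateAt-id-local r N refl i) l)
    cancel : ∀ {x y} → + 0 ≡ (+ 0 + x) + (y + + 0) → y ≡ - x
    cancel {x} {y} eq = inverseʳ-unique x y (trans (cong₂ _+_ (sym (ℤP.+-identityˡ x)) (sym (ℤP.+-identityʳ y))) (sym eq))

  minor-setRow : ∀ {c} (N : Matrix (suc (suc c))) r w j →
                 minor (setRow N (suc r) w) j ≐ setRow (minor N j) r (w ∘ punchIn j)
  minor-setRow N r w j a = cong-app (setRow-map (_∘ punchIn j) (N ∘ suc) r w a)

  det-linear : ∀ {c} → RowLinear (det {c})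
  det-linear {suc c} N zero u v x y = begin
    det (setRow N zero (λ l → x * u l + y * v l))
      ≡⟨ det-expand (setRow N zero (λ l → x * u l + y * v l)) ⟩
    sum (λ j → sgn j * ((x * u j + y * v j) * det (minor N j)))
      ≡⟨ sum-cong-≗ (λ j → distrib x y (sgn j) (u j) (v j) (det (minor N j))) ⟩
    sum (λ j → x * eU j + y * eV j)
      ≡⟨ sum-linear x y eU eV ⟩
    x * sum eU + y * sum eV
      ≡⟨ cong₂ (λ p q → x * p + y * q) (det-expand (setRow N zero u)) (det-expand (setRow N zero v)) ⟨
    x * det (setRow N zero u) + y * det (setRow N zero v) ∎
    where
    eU eV : Fin (suc c) → ℤ
    eU j = sgn j * (u j * det (minor N j))
    eV j = sgn j * (v j * det (minor N j))
    distrib : ∀ x y s p q d → s * ((x * p + y * q) * d) ≡ x * (s * (p * d)) + y * (s * (q * d))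
    distrib = solve-∀
  det-linear {suc (suc c)} N (suc r) u v x y = begin
    det (setRow N (suc r) (λ l → x * u l + y * v l))
      ≡⟨ expand (λ l → x * u l + y * v l) ⟩
    sum (λ j → sgn j * (N zero j * det (setRow (minor N j) r (λ l → x * u (punchIn j l) + y * v (punchIn j l)))))
      ≡⟨ sum-cong-≗ (λ j → cong (λ d → sgn j * (N zero j * d)) (det-linear (minor N j) r (u ∘ punchIn j) (v ∘ punchIn j) x y)) ⟩
    sum (λ j → sgn j * (N zero j * (x * dU j + y * dV j)))
      ≡⟨ sum-cong-≗ (λ j → distrib x y (sgn j) (N zero j) (dU j) (dV j)) ⟩
    sum (λ j → x * eU j + y * eV j)
      ≡⟨ sum-linear x y eU eV ⟩
    x * sum eU + y * sum eV
      ≡⟨ cong₂ (λ p q → x * p + y * q) (expand u) (expand v) ⟨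
    x * det (setRow N (suc r) u) + y * det (setRow N (suc r) v) ∎
    where
    expand : ∀ w → det (setRow N (suc r) w) ≡ sum (λ j → sgn j * (N zero j * det (setRow (minor N j) r (w ∘ punchIn j))))
    expand w = trans (det-expand (setRow N (suc r) w))
                     (sum-cong-≗ (λ j → cong (λ d → sgn j * (N zero j * d)) (det-cong (minor-setRow N r w j))))
    dU dV eU eV : Fin (suc (suc c)) → ℤ
    dU j = det (setRow (minor N j) r (u ∘ punchIn j))
    dV j = det (setRow (minor N j) r (v ∘ punchIn j))
    eU j = sgn j * (N zero j * dU j)
    eV j = sgn j * (N zero j * dV j)
    distrib : ∀ x y s n p q → s * (n * (x * p + y * q)) ≡ x * (s * (n * p)) + y * (s * (n * q))
    distrib = solve-∀
  punchIn-punchIn-comm : ∀ {c} (j l : Fin (suc (suc c))) (j≢l : j ≢ l) (l≢j : l ≢ j) (y : Fin c) →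
                         punchIn j (punchIn (punchOut j≢l) y) ≡ punchIn l (punchIn (punchOut l≢j) y)
  punchIn-punchIn-comm zero    zero    j≢l _ y = ⊥-elim (j≢l refl)
  punchIn-punchIn-comm zero    (suc l) _   _ y = refl
  punchIn-punchIn-comm (suc j) zero    _   _ y = refl
  punchIn-punchIn-comm {suc c} (suc j) (suc l) _ _ zero = refl
  punchIn-punchIn-comm {suc c} (suc j) (suc l) j≢l l≢j (suc y) =
    cong suc (punchIn-punchIn-comm j l (j≢l ∘ cong suc) (l≢j ∘ cong suc) y)

  neg-*-neg : ∀ a b → - a * - b ≡ a * b
  neg-*-neg = solve-∀

  sgn-punchOut-anti : ∀ {c} (j l : Fin (suc (suc c))) (j≢l : j ≢ l) (l≢j : l ≢ j) →
                      sgn j * sgn (punchOut j≢l) ≡ - (sgn l * sgn (punchOut l≢j))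
  sgn-punchOut-anti zero    zero    j≢l _ = ⊥-elim (j≢l refl)
  sgn-punchOut-anti zero    (suc l) _   _ = ring (sgn l)
    where ring : ∀ x → + 1 * x ≡ - (- x * + 1)
          ring = solve-∀
  sgn-punchOut-anti (suc j) zero    _   _ = ring (sgn j)
    where ring : ∀ x → - x * + 1 ≡ - (+ 1 * x)
          ring = solve-∀
  sgn-punchOut-anti {zero}  (suc zero) (suc zero) j≢l _ = ⊥-elim (j≢l refl)
  sgn-punchOut-anti {suc c} (suc j) (suc l) j≢l l≢j = begin
    - sgn j * - sgn (punchOut j≢l')      ≡⟨ neg-*-neg (sgn j) (sgn (punchOut j≢l')) ⟩
    sgn j * sgn (punchOut j≢l')          ≡⟨ sgn-punchOut-anti j l j≢l' l≢j' ⟩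
    - (sgn l * sgn (punchOut l≢j'))      ≡⟨ cong -_ (neg-*-neg (sgn l) (sgn (punchOut l≢j'))) ⟨
    - (- sgn l * - sgn (punchOut l≢j'))  ∎
    where
    j≢l' = j≢l ∘ cong suc
    l≢j' = l≢j ∘ cong suc

  self-neg⇒0 : ∀ a → a ≡ - a → a ≡ + 0
  self-neg⇒0 (+ zero)   _  = refl
  self-neg⇒0 (+ suc n)  ()
  self-neg⇒0 ℤ.-[1+ n ] ()

  -- Expanding along rows 0 and 1 gives a double sum whose terms cancel in pairs.
  det-equalRows₀₁ : ∀ {c} (M : Matrix (suc (suc c))) → M zero ≗ M (suc zero) → det M ≡ + 0
  det-equalRows₀₁ {c} M M₀≗M₁ = begin
    det M                   ≡⟨ double-expand ⟩
    sum (λ j → sum (Q j))   ≡⟨ sum-cong-≗ sum-Q≡sum-H ⟩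
    S                       ≡⟨ self-neg⇒0 S S≡-S ⟩
    + 0                     ∎
    where
    K : Fin (suc (suc c)) → Fin (suc c) → Matrix c
    K j b = minor (minor M j) b
    Q : Fin (suc (suc c)) → Fin (suc c) → ℤ
    Q j b = (sgn j * sgn b) * ((M zero j * M zero (punchIn j b)) * det (K j b))

    double-expand : det M ≡ sum (λ j → sum (Q j))
    double-expand = trans (det-expand M) (sum-cong-≗ expand-minor)
      where
      rearrange : ∀ s t x y d → s * (x * (t * (y * d))) ≡ (s * t) * ((x * y) * d)
      rearrange = solve-∀
      expand-minor : ∀ j → sgn j * (M zero j * det (minor M j)) ≡ sum (Q j)
      expand-minor j = begin
        sgn j * (M zero j * det (minor M j))
          ≡⟨ cong (λ d → sgn j * (M zero j * d)) (det-expand (minor M j)) ⟩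
        sgn j * (M zero j * sum f)
          ≡⟨ trans (sum-*ˡ (sgn j) (λ b → M zero j * f b)) (cong (sgn j *_) (sum-*ˡ (M zero j) f)) ⟨
        sum (λ b → sgn j * (M zero j * f b))
          ≡⟨ sum-cong-≗ (λ b → trans (cong (λ x → sgn j * (M zero j * (sgn b * (x * det (K j b))))) (sym (M₀≗M₁ (punchIn j b))))
                                     (rearrange (sgn j) (sgn b) (M zero j) (M zero (punchIn j b)) (det (K j b)))) ⟩
        sum (Q j) ∎
        where
        f : Fin (suc c) → ℤ
        f b = sgn b * (M (suc zero) (punchIn j b) * det (K j b))

    H : Fin (suc (suc c)) → Fin (suc (suc c)) → ℤ
    H j l with j Fin.≟ l
    ... | yes _   = + 0
    ... | no j≢l  = Q j (punchOut j≢l)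

    H-diag : ∀ j → H j j ≡ + 0
    H-diag j with j Fin.≟ j
    ... | yes _  = refl
    ... | no j≢j = ⊥-elim (j≢j refl)

    H-punchIn : ∀ j b → H j (punchIn j b) ≡ Q j b
    H-punchIn j b with j Fin.≟ punchIn j b
    ... | yes j≡ = ⊥-elim (punchInᵢ≢i j b (sym j≡))
    ... | no j≢  = cong (Q j) (trans (punchOut-cong j refl) (punchOut-punchIn j))

    H-anti : ∀ j l → H j l ≡ - H l j
    H-anti j l with j Fin.≟ l | l Fin.≟ j
    ... | yes _   | yes _   = refl
    ... | yes j≡l | no l≢j  = ⊥-elim (l≢j (sym j≡l))
    ... | no j≢l  | yes l≡j = ⊥-elim (j≢l (sym l≡j))
    ... | no j≢l  | no l≢j  = begin
      (sgn j * sgn (punchOut j≢l)) * ((M zero j * M zero (punchIn j (punchOut j≢l))) * det (K j (punchOut j≢l)))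
        ≡⟨ cong₂ (λ s x → s * ((M zero j * M zero x) * det (K j (punchOut j≢l))))
                 (sgn-punchOut-anti j l j≢l l≢j) (punchIn-punchOut j≢l) ⟩
      - (sgn l * sgn (punchOut l≢j)) * ((M zero j * M zero l) * det (K j (punchOut j≢l)))
        ≡⟨ cong (λ d → - (sgn l * sgn (punchOut l≢j)) * ((M zero j * M zero l) * d))
                (det-cong (λ x y → cong (M (suc (suc x))) (punchIn-punchIn-comm j l j≢l l≢j y))) ⟩
      - (sgn l * sgn (punchOut l≢j)) * ((M zero j * M zero l) * det (K l (punchOut l≢j)))
        ≡⟨ anti (sgn l * sgn (punchOut l≢j)) (M zero j) (M zero l) (det (K l (punchOut l≢j))) ⟩
      - ((sgn l * sgn (punchOut l≢j)) * ((M zero l * M zero j) * det (K l (punchOut l≢j))))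
        ≡⟨ cong (λ x → - ((sgn l * sgn (punchOut l≢j)) * ((M zero l * M zero x) * det (K l (punchOut l≢j)))))
                (punchIn-punchOut l≢j) ⟨
      - ((sgn l * sgn (punchOut l≢j)) * ((M zero l * M zero (punchIn l (punchOut l≢j))) * det (K l (punchOut l≢j)))) ∎
      where
      anti : ∀ s x y d → (- s) * ((x * y) * d) ≡ - (s * ((y * x) * d))
      anti = solve-∀

    sum-Q≡sum-H : ∀ j → sum (Q j) ≡ sum (H j)
    sum-Q≡sum-H j = sym (begin
      sum (H j)                                    ≡⟨ sum-remove {i = j} (H j) ⟩
      H j j + sum (λ b → H j (punchIn j b))        ≡⟨ cong₂ _+_ (H-diag j) (sum-cong-≗ (H-punchIn j)) ⟩
      + 0 + sum (Q j)                              ≡⟨ ℤP.+-identityˡ (sum (Q j)) ⟩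
      sum (Q j)                                    ∎)

    S : ℤ
    S = sum (λ j → sum (H j))

    S≡-S : S ≡ - S
    S≡-S = begin
      S                                   ≡⟨ ∑-comm H ⟩
      sum (λ l → sum (λ j → H j l))       ≡⟨ sum-cong-≗ (λ l → sum-cong-≗ (λ j → H-anti j l)) ⟩
      sum (λ l → sum (λ j → - H l j))     ≡⟨ sum-cong-≗ (λ l → sum-neg (H l)) ⟩
      sum (λ l → - sum (H l))             ≡⟨ sum-neg (λ l → sum (H l)) ⟩
      - S                                 ∎

  minor-swapRows : ∀ {c} (N : Matrix (suc (suc (suc c)))) b j →
                   minor (swapRows N (suc zero) (suc (suc b))) j ≐ swapRows (minor N j) zero (suc b)
  minor-swapRows N b j zero    l = refl
  minor-swapRows N b j (suc a) l = cong-app (setRow-map (_∘ punchIn j) (λ a → N (suc (suc a))) b (N (suc zero)) a) l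

  det-isAlternating : ∀ {c} → Alternating (det {c}) → IsAlternating (det {c})
  det-isAlternating alt = record
    { isMultilinear = record { extensional = det-cong ; linear = det-linear }
    ; alternating   = alt
    }

  -- Swapping rows 1 and b + 2 turns equal rows 0 and b + 2 into equal rows 0 and 1.
  det-equalRows₀₂₊ : ∀ {c} → Alternating (det {suc (suc c)}) →
                   ∀ (N : Matrix (suc (suc (suc c)))) b → N zero ≗ N (suc (suc b)) → det N ≡ + 0
  det-equalRows₀₂₊ {c} alt N b N₀≗N₂₊ᵦ = begin
    det N      ≡⟨ ℤP.neg-involutive (det N) ⟨
    - - det N  ≡⟨ cong -_ swap-negates ⟨
    - det N'   ≡⟨ cong -_ (det-equalRows₀₁ N' N₀≗N₂₊ᵦ) ⟩
    + 0        ∎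
    where
    N' : Matrix (suc (suc (suc c)))
    N' = swapRows N (suc zero) (suc (suc b))
    term : (Fin (suc (suc (suc c))) → ℤ) → Fin (suc (suc (suc c))) → ℤ
    term d j = sgn j * (N zero j * d j)
    swap-negates : det N' ≡ - det N
    swap-negates = begin
      det N'                                        ≡⟨ det-expand N' ⟩
      sum (term (λ j → det (minor N' j)))           ≡⟨ sum-cong-≗ (λ j → cong (λ d → term (λ _ → d) j)
                                                         (trans (det-cong (minor-swapRows N b j))
                                                                (swapRows-negates (det-isAlternating alt) (minor N j)
                                                                                  {zero} {suc b} (λ ())))) ⟩
      sum (term (λ j → - det (minor N j)))          ≡⟨ sum-cong-≗ (λ j → neg-inside (sgn j) (N zero j) (det (minor N j))) ⟩
      sum (λ j → - term (λ j → det (minor N j)) j)  ≡⟨ sum-neg (term (λ j → det (minor N j))) ⟩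
      - sum (term (λ j → det (minor N j)))          ≡⟨ cong -_ (det-expand N) ⟨
      - det N                                       ∎
      where
      neg-inside : ∀ s x d → s * (x * - d) ≡ - (s * (x * d))
      neg-inside = solve-∀

  det-alternating : ∀ {c} → Alternating (det {c})
  det-equalRows₀₁₊ : ∀ {c} (N : Matrix (suc c)) b → N zero ≗ N (suc b) → det N ≡ + 0
  det-alternating {suc c} N {zero}  {zero}  r≢r' _   = ⊥-elim (r≢r' refl)
  det-alternating {suc c} N {suc a} {zero}  _    eq  = det-equalRows₀₁₊ N a (λ l → sym (eq l))
  det-alternating {suc c} N {zero}  {suc b} _    eq  = det-equalRows₀₁₊ N b eq
  det-alternating {suc c} N {suc a} {suc b} r≢r' eq  = trans (det-expand N) (sum-zero λ j → begin
    sgn j * (N zero j * det (minor N j))  ≡⟨ cong (λ d → sgn j * (N zero j * d))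
                                               (det-alternating (minor N j) (r≢r' ∘ cong suc) (λ l → eq (punchIn j l))) ⟩
    sgn j * (N zero j * + 0)              ≡⟨ cong (sgn j *_) (ℤP.*-zeroʳ (N zero j)) ⟩
    sgn j * + 0                           ≡⟨ ℤP.*-zeroʳ (sgn j) ⟩
    + 0                                   ∎)
  det-equalRows₀₁₊ {suc c}       N zero    eq = det-equalRows₀₁ N eq
  det-equalRows₀₁₊ {suc (suc c)} N (suc b) eq = det-equalRows₀₂₊ det-alternating N b eq

  record IsLinearMap {b b'} (R : (Fin b → ℤ) → (Fin b' → ℤ)) : Set where
    field
      cong-≗ : ∀ {u v} → u ≗ v → R u ≗ R v
      linear : ∀ u v x y → R (λ l → x * u l + y * v l) ≗ (λ l → x * R u l + y * R v l)

  id-isLinearMap : ∀ {b} → IsLinearMap {b} id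
  id-isLinearMap = record { cong-≗ = id ; linear = λ u v x y l → refl }

  insertZero : ∀ {b} → Fin (suc b) → (Fin b → ℤ) → (Fin (suc b) → ℤ)
  insertZero j v = insertAt v j (+ 0)

  insertZero-isLinearMap : ∀ {b} (j : Fin (suc b)) → IsLinearMap (insertZero j)
  insertZero-isLinearMap j = record
    { cong-≗ = λ {u} {v} u≗v → punchIn-elim j (λ l → insertZero j u l ≡ insertZero j v l)
        (trans (insertAt-lookup u j (+ 0)) (sym (insertAt-lookup v j (+ 0))))
        (λ b → trans (insertAt-punchIn u j (+ 0) b) (trans (u≗v b) (sym (insertAt-punchIn v j (+ 0) b))))
    ; linear = λ u v x y → punchIn-elim j
        (λ l → insertZero j (λ l → x * u l + y * v l) l ≡ x * insertZero j u l + y * insertZero j v l)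
        (begin
          insertZero j (λ l → x * u l + y * v l) j  ≡⟨ insertAt-lookup (λ l → x * u l + y * v l) j (+ 0) ⟩
          + 0                                       ≡⟨ zeros x y ⟩
          x * + 0 + y * + 0                         ≡⟨ cong₂ (λ p q → x * p + y * q) (insertAt-lookup u j (+ 0))
                                                                                     (insertAt-lookup v j (+ 0)) ⟨
          x * insertZero j u j + y * insertZero j v j ∎)
        (λ b → trans (insertAt-punchIn (λ l → x * u l + y * v l) j (+ 0) b)
                     (sym (cong₂ (λ p q → x * p + y * q) (insertAt-punchIn u j (+ 0) b) (insertAt-punchIn v j (+ 0) b))))
    }
    where
    zeros : ∀ x y → + 0 ≡ x * + 0 + y * + 0
    zeros = solve-∀

  withRow₀ : ∀ {m b b'} → (Mat (suc m) b' → ℤ) → (Fin b' → ℤ) → ((Fin b → ℤ) → (Fin b' → ℤ)) → Mat m b → ℤ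
  withRow₀ f x₀ R N = f (x₀ ∷ map R N)

  module _ {m b b'} {f : Mat (suc m) b' → ℤ} (x₀ : Fin b' → ℤ)
           {R : (Fin b → ℤ) → (Fin b' → ℤ)} (R-linear : IsLinearMap R) where

    open IsLinearMap R-linear renaming (linear to R-linear-comb)

    private
      prepend-cong : ∀ {A B : Mat m b} → A ≐ B → (x₀ ∷ map R A) ≐ (x₀ ∷ map R B)
      prepend-cong A≐B zero    l = refl
      prepend-cong A≐B (suc a) l = cong-≗ (A≐B a) l

      prepend-setRow : ∀ (N : Mat m b) r w → (x₀ ∷ map R (setRow N r w)) ≐ setRow (x₀ ∷ map R N) (suc r) (R w)
      prepend-setRow N r w zero    l = refl
      prepend-setRow N r w (suc a) l = cong-app (setRow-map R N r w a) l

    withRow₀-isMultilinear : IsMultilinear f → IsMultilinear (withRow₀ f x₀ R)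
    withRow₀-isMultilinear f-ml = record
      { extensional = extensional ∘ prepend-cong
      ; linear      = λ N r u v x y → begin
          f (x₀ ∷ map R (setRow N r (λ l → x * u l + y * v l)))
            ≡⟨ extensional (prepend-setRow N r (λ l → x * u l + y * v l)) ⟩
          f (setRow (x₀ ∷ map R N) (suc r) (R (λ l → x * u l + y * v l)))
            ≡⟨ extensional (setRow-cong (x₀ ∷ map R N) (suc r) (R-linear-comb u v x y)) ⟩
          f (setRow (x₀ ∷ map R N) (suc r) (λ l → x * R u l + y * R v l))
            ≡⟨ linear (x₀ ∷ map R N) (suc r) (R u) (R v) x y ⟩
          x * f (setRow (x₀ ∷ map R N) (suc r) (R u)) + y * f (setRow (x₀ ∷ map R N) (suc r) (R v))
            ≡⟨ cong₂ (λ p q → x * p + y * q) (extensional (prepend-setRow N r u)) (extensional (prepend-setRow N r v)) ⟨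
          x * withRow₀ f x₀ R (setRow N r u) + y * withRow₀ f x₀ R (setRow N r v) ∎
      }
      where open IsMultilinear f-ml

    withRow₀-isAlternating : IsAlternating f → IsAlternating (withRow₀ f x₀ R)
    withRow₀-isAlternating f-alt = record
      { isMultilinear = withRow₀-isMultilinear isMultilinear
      ; alternating   = λ N r≢r' Nr≗Nr' → alternating (x₀ ∷ map R N) (r≢r' ∘ FinP.suc-injective) (cong-≗ Nr≗Nr')
      }
      where open IsAlternating f-alt

  clearAlong : ∀ {m n} {G : Mat m n → ℤ} → IsMultilinear G → (w : Fin n → ℤ) →
               (∀ N a → N a ≗ w → G N ≡ + 0) → (φ : (Fin n → ℤ) → ℤ) →
               ∀ N → G N ≡ G (λ a l → N a l - φ (N a) * w l)
  clearAlong {zero}      G-ml w vanishes φ N = IsMultilinear.extensional G-ml (λ ())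
  clearAlong {suc m} {n} {G} G-ml w vanishes φ N = begin
    G N                                              ≡⟨ extensional (setRow-unique zero (λ l → split (N zero l) (φ (N zero)) (w l))
                                                                                   (λ _ _ _ → refl)) ⟨
    G (setRow N zero (λ l → + 1 * x₀ l + φ (N zero) * w l))
                                                     ≡⟨ linear N zero x₀ w (+ 1) (φ (N zero)) ⟩
    + 1 * G (setRow N zero x₀) + φ (N zero) * G (setRow N zero w)
                                                     ≡⟨ cong (λ z → + 1 * G (setRow N zero x₀) + φ (N zero) * z)
                                                             (vanishes (setRow N zero w) zero (λ l → refl)) ⟩
    + 1 * G (setRow N zero x₀) + φ (N zero) * + 0    ≡⟨ drop (G (setRow N zero x₀)) (φ (N zero)) ⟩
    G (setRow N zero x₀)                             ≡⟨ extensional (λ { zero l → refl ; (suc a) l → refl }) ⟩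
    G' (N ∘ suc)                                     ≡⟨ clearAlong (withRow₀-isMultilinear x₀ id-isLinearMap G-ml) w
                                                                   (λ N' a → vanishes (x₀ ∷ N') (suc a)) φ (N ∘ suc) ⟩
    G' (λ a l → N (suc a) l - φ (N (suc a)) * w l)   ≡⟨ extensional (λ { zero l → refl ; (suc a) l → refl }) ⟩
    G (λ a l → N a l - φ (N a) * w l)                ∎
    where
    open IsMultilinear G-ml
    x₀ : Fin n → ℤ
    x₀ l = N zero l - φ (N zero) * w l
    G' = withRow₀ G x₀ id
    split : ∀ a p w → a ≡ + 1 * (a - p * w) + p * w
    split = solve-∀
    drop : ∀ a p → + 1 * a + p * + 0 ≡ a
    drop = solve-∀

  linear-sum : ∀ {m n} {f : Mat m n → ℤ} → IsMultilinear f → ∀ N r {k} (x : Fin k → ℤ) (W : Fin k → Fin n → ℤ) →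
               f (setRow N r (λ l → sum (λ t → x t * W t l))) ≡ sum (λ t → x t * f (setRow N r (W t)))
  linear-sum f-ml N r {zero}  x W = IsMultilinear.linear f-ml N r (N r) (N r) (+ 0) (+ 0)
  linear-sum {f = f} f-ml N r {suc k} x W = begin
    f (setRow N r (λ l → x zero * W zero l + rest l))          ≡⟨ extensional (setRow-cong N r (λ l →
                                                                    cong (_+_ (x zero * W zero l)) (sym (ℤP.*-identityˡ (rest l))))) ⟩
    f (setRow N r (λ l → x zero * W zero l + + 1 * rest l))   ≡⟨ linear N r (W zero) rest (x zero) (+ 1) ⟩
    x zero * f (setRow N r (W zero)) + + 1 * f (setRow N r rest)
                                                              ≡⟨ cong (_+_ (x zero * f (setRow N r (W zero))))
                                                                   (trans (ℤP.*-identityˡ (f (setRow N r rest)))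
                                                                          (linear-sum f-ml N r (x ∘ suc) (W ∘ suc))) ⟩
    sum (λ t → x t * f (setRow N r (W t)))                    ∎
    where
    open IsMultilinear f-ml
    rest : Fin _ → ℤ
    rest l = sum (λ t → x (suc t) * W (suc t) l)

  cycleRows : ∀ {c} → Fin (suc c) → Matrix (suc c)
  cycleRows j = δ j ∷ (δ ∘ punchIn j)

  cycleRows-sgn : ∀ {c} {f : Matrix (suc c) → ℤ} → IsAlternating f → ∀ j → f (cycleRows j) ≡ sgn j * f δ
  cycleRows-sgn f-alt zero = trans (IsAlternating.extensional f-alt (λ { zero l → refl ; (suc b) l → refl }))
                                   (sym (ℤP.*-identityˡ _))
  cycleRows-sgn {suc c} {f} f-alt (suc j) = begin
    f (cycleRows (suc j))      ≡⟨ extensional (λ { zero zero → refl ; zero (suc l) → refl ; (suc zero) l → refl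
                                                 ; (suc (suc b)) zero → refl ; (suc (suc b)) (suc l) → refl }) ⟩
    f (swapRows X zero (suc zero))  ≡⟨ swapRows-negates f-alt X {zero} {suc zero} (λ ()) ⟩
    - f X                      ≡⟨ cong -_ (cycleRows-sgn (withRow₀-isAlternating (δ zero) (insertZero-isLinearMap zero) f-alt) j) ⟩
    - (sgn j * f₀ δ)           ≡⟨ cong (λ z → - (sgn j * z))
                                       (extensional (λ { zero l → refl ; (suc a) zero → refl ; (suc a) (suc l) → refl })) ⟩
    - (sgn j * f δ)            ≡⟨ ℤP.neg-distribˡ-* (sgn j) (f δ) ⟩
    sgn (suc j) * f δ          ∎
    where
    open IsAlternating f-alt
    f₀ : Matrix (suc c) → ℤ
    f₀ = withRow₀ f (δ zero) (insertZero zero)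
    X : Matrix (suc (suc c))
    X = δ zero ∷ map (insertZero zero) (cycleRows j)

  -- Expanding f along row 0 reduces to rows e_j ∷ (rest); clearing column j of the rest leaves
  -- an alternating form of the minor, which is handled by induction.
  alternating-unique : ∀ {c} {f : Matrix c → ℤ} → IsAlternating f → ∀ M → f M ≡ det M * f δ
  alternating-unique {zero} f-alt M = trans (IsAlternating.extensional f-alt (λ ())) (sym (ℤP.*-identityˡ _))
  alternating-unique {suc c} {f} f-alt M = begin
    f M                                                       ≡⟨ extensional (setRow-unique zero
                                                                   (λ l → sym (sum-δʳ l (M zero))) (λ _ _ _ → refl)) ⟨
    f (setRow M zero (λ l → sum (λ j → M zero j * δ j l)))    ≡⟨ linear-sum isMultilinear M zero (M zero) δ ⟩
    sum (λ j → M zero j * f (setRow M zero (δ j)))            ≡⟨ sum-cong-≗ (λ j → cong (M zero j *_) (unitRow j)) ⟩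
    sum (λ j → M zero j * (det (minor M j) * (sgn j * f δ)))  ≡⟨ sum-cong-≗ (λ j →
                                                                   rearrange (M zero j) (det (minor M j)) (sgn j) (f δ)) ⟩
    sum (λ j → sgn j * (M zero j * det (minor M j)) * f δ)    ≡⟨ sum-*ʳ (f δ) (λ j → sgn j * (M zero j * det (minor M j))) ⟩
    sum (λ j → sgn j * (M zero j * det (minor M j))) * f δ    ≡⟨ cong (_* f δ) (det-expand M) ⟨
    det M * f δ                                               ∎
    where
    open IsAlternating f-alt
    rearrange : ∀ m d s F → m * (d * (s * F)) ≡ s * (m * d) * F
    rearrange = solve-∀

    unitRow : ∀ j → f (setRow M zero (δ j)) ≡ det (minor M j) * (sgn j * f δ)
    unitRow j = begin
      f (setRow M zero (δ j))                          ≡⟨ extensional (λ { zero l → refl ; (suc a) l → refl }) ⟩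
      G (M ∘ suc)                                      ≡⟨ clearAlong (withRow₀-isMultilinear (δ j) id-isLinearMap isMultilinear) (δ j)
                                                                     G-vanishes (λ row → row j) (M ∘ suc) ⟩
      G (λ a l → M (suc a) l - M (suc a) j * δ j l)    ≡⟨ extensional (λ { zero l → refl ; (suc a) l → cleared a l }) ⟩
      h (minor M j)                                    ≡⟨ alternating-unique (withRow₀-isAlternating (δ j) (insertZero-isLinearMap j) f-alt)
                                                                             (minor M j) ⟩
      det (minor M j) * h δ                            ≡⟨ cong (det (minor M j) *_)
                                                               (extensional (λ { zero l → refl ; (suc b) l → insertZero-δ b l })) ⟩
      det (minor M j) * f (cycleRows j)                ≡⟨ cong (det (minor M j) *_) (cycleRows-sgn f-alt j) ⟩
      det (minor M j) * (sgn j * f δ)                  ∎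
      where
      G : Mat c (suc c) → ℤ
      G = withRow₀ f (δ j) id
      h : Matrix c → ℤ
      h = withRow₀ f (δ j) (insertZero j)
      G-vanishes : ∀ N a → N a ≗ δ j → G N ≡ + 0
      G-vanishes N a Na≗δj = alternating (δ j ∷ N) {zero} {suc a} (λ ()) (λ l → sym (Na≗δj l))
      cleared : ∀ a l → M (suc a) l - M (suc a) j * δ j l ≡ insertZero j (minor M j a) l
      cleared a = punchIn-elim j (λ l → M (suc a) l - M (suc a) j * δ j l ≡ insertZero j (minor M j a) l)
        (begin
          M (suc a) j - M (suc a) j * δ j j  ≡⟨ cong (λ d → M (suc a) j - M (suc a) j * d) (δ-refl j) ⟩
          M (suc a) j - M (suc a) j * + 1    ≡⟨ cancel (M (suc a) j) ⟩
          + 0                                ≡⟨ insertAt-lookup (minor M j a) j (+ 0) ⟨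
          insertZero j (minor M j a) j       ∎)
        (λ b → begin
          M (suc a) (punchIn j b) - M (suc a) j * δ j (punchIn j b)  ≡⟨ cong (λ d → M (suc a) (punchIn j b) - M (suc a) j * d)
                                                                          (δ-≢ (punchInᵢ≢i j b ∘ sym)) ⟩
          M (suc a) (punchIn j b) - M (suc a) j * + 0                ≡⟨ keep (M (suc a) (punchIn j b)) (M (suc a) j) ⟩
          M (suc a) (punchIn j b)                                    ≡⟨ insertAt-punchIn (minor M j a) j (+ 0) b ⟨
          insertZero j (minor M j a) (punchIn j b)                   ∎)
        where
        cancel : ∀ x → x - x * + 1 ≡ + 0
        cancel = solve-∀
        keep : ∀ x y → x - y * + 0 ≡ x
        keep = solve-∀
      insertZero-δ : ∀ b l → insertZero j (δ b) l ≡ δ (punchIn j b) l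
      insertZero-δ b = punchIn-elim j (λ l → insertZero j (δ b) l ≡ δ (punchIn j b) l)
        (trans (insertAt-lookup (δ b) j (+ 0)) (sym (δ-≢ (punchInᵢ≢i j b))))
        (λ b' → trans (insertAt-punchIn (δ b) j (+ 0) b') (sym (δ-punchIn j b b')))

  setRow-· : ∀ {a b c} (A : Mat a b) (B : Mat b c) r w → setRow A r w · B ≐ setRow (A · B) r (λ l → sum (λ t → w t * B t l))
  setRow-· A B r w i j = sym (setRow-unique r
    (λ l → sum-cong-≗ (λ t → cong (_* B t l) (cong-app (setRow-row A r w) t)))
    (λ i i≢r l → sum-cong-≗ (λ t → cong (_* B t l) (cong-app (setRow-other A r w i≢r) t))) i j)

  det-· : ∀ {c} (A B : Matrix c) → det (A · B) ≡ det A * det B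
  det-· A B = trans (alternating-unique f-alt A) (cong (det A *_) (det-cong (·-identityˡ B)))
    where
    f : Matrix _ → ℤ
    f X = det (X · B)
    f-alt : IsAlternating f
    f-alt = record
      { isMultilinear = record
        { extensional = det-cong ∘ ·-congʳ B
        ; linear      = λ N r u v x y → begin
            det (setRow N r (λ l → x * u l + y * v l) · B)
              ≡⟨ det-cong (setRow-· N B r (λ l → x * u l + y * v l)) ⟩
            det (setRow (N · B) r (λ l → sum (λ t → (x * u t + y * v t) * B t l)))
              ≡⟨ det-cong (setRow-cong (N · B) r (λ l → trans (sum-cong-≗ (λ t → distrib x y (u t) (v t) (B t l)))
                                                              (sum-linear x y (λ t → u t * B t l) (λ t → v t * B t l)))) ⟩
            det (setRow (N · B) r (λ l → x * (u ·ᵥ l) + y * (v ·ᵥ l)))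
              ≡⟨ det-linear (N · B) r (_·ᵥ_ u) (_·ᵥ_ v) x y ⟩
            x * det (setRow (N · B) r (_·ᵥ_ u)) + y * det (setRow (N · B) r (_·ᵥ_ v))
              ≡⟨ cong₂ (λ p q → x * p + y * q) (det-cong (setRow-· N B r u)) (det-cong (setRow-· N B r v)) ⟨
            x * f (setRow N r u) + y * f (setRow N r v) ∎
        }
      ; alternating = λ N r≢r' Nr≗Nr' → det-alternating (N · B) r≢r' (λ l → sum-cong-≗ (λ t → cong (_* B t l) (Nr≗Nr' t)))
      }
      where
      _·ᵥ_ : (Fin _ → ℤ) → Fin _ → ℤ
      w ·ᵥ l = sum (λ t → w t * B t l)
      distrib : ∀ x y p q b → (x * p + y * q) * b ≡ x * (p * b) + y * (q * b)
      distrib = solve-∀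

  det-δ : ∀ {c} → det (δ {c}) ≡ + 1
  det-δ {zero}  = refl
  det-δ {suc c} = begin
    det (δ {suc c})                                                 ≡⟨ det-expand (δ {suc c}) ⟩
    + 1 * (+ 1 * det (δ {c})) + sum (λ j → sgn (suc j) * (+ 0 * det (minor (δ {suc c}) (suc j))))
                                                                    ≡⟨ cong₂ _+_ (trans (ℤP.*-identityˡ (+ 1 * det (δ {c})))
                                                                                        (trans (ℤP.*-identityˡ (det (δ {c}))) (det-δ {c})))
                                                                                 (sum-zero {f = λ j → sgn (suc j) * (+ 0 * det (minor (δ {suc c}) (suc j)))}
                                                                                           (λ j → ℤP.*-zeroʳ (sgn (suc j)))) ⟩
    + 1 + + 0                                                       ∎

  unit-* : ∀ a b → a * b ≡ + 1 → a ≡ + 1 ⊎ a ≡ - + 1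
  unit-* (+ n)      b ab≡1 = inj₁ (cong +_ (ℕP.m*n≡1⇒m≡1 n ℤ.∣ b ∣ (trans (sym (ℤP.abs-* (+ n) b)) (cong ℤ.∣_∣ ab≡1))))
  unit-* ℤ.-[1+ n ] b ab≡1 = inj₂ (cong ℤ.-[1+_] (ℕP.suc-injective
    (ℕP.m*n≡1⇒m≡1 (suc n) ℤ.∣ b ∣ (trans (sym (ℤP.abs-* ℤ.-[1+ n ] b)) (cong ℤ.∣_∣ ab≡1)))))

  rightInverse⇒unimodular : ∀ {c} {A B : Matrix c} → A · B ≐ δ → Unimodular A
  rightInverse⇒unimodular {c} {A} {B} AB≐δ = unit-* (det A) (det B) (begin
    det A * det B  ≡⟨ det-· A B ⟨
    det (A · B)    ≡⟨ det-cong AB≐δ ⟩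
    det (δ {c})    ≡⟨ det-δ {c} ⟩
    + 1            ∎)

open Determinant using (rightInverse⇒unimodular)

module SubsetLemmas where

  open import Data.Vec using (_∷_; insertAt; updateAt; here; there)
  open import Data.Vec.Properties using ([]=⇒lookup; lookup⇒[]=; lookup∘updateAt; lookup∘updateAt′;
                                         insertAt-lookup; insertAt-punchIn)
  open import Data.Fin.Subset.Properties using (_∈?_; ⊆-antisym; p⊂q⇒∣p∣<∣q∣; p⊆q⇒∣p∣≤∣q∣)
  open import Relation.Nullary.Decidable using (decidable-stable; ¬?; _×-dec_)

  ∈⇒lookup : ∀ {m} {s : Subset m} {i} → i ∈ s → lookup s i ≡ true
  ∈⇒lookup = []=⇒lookup

  lookup⇒∈ : ∀ {m} {s : Subset m} {i} → lookup s i ≡ true → i ∈ s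
  lookup⇒∈ {s = s} {i} = lookup⇒[]= i s

  ∈-insertAt⁻ : ∀ {m} (s : Subset m) p b {i} → punchIn p i ∈ insertAt s p b → i ∈ s
  ∈-insertAt⁻ s p b {i} i∈ = lookup⇒∈ (trans (sym (insertAt-punchIn s p b i)) (∈⇒lookup i∈))

  ∈-insertAt⁺ : ∀ {m} (s : Subset m) p b {i} → i ∈ s → punchIn p i ∈ insertAt s p b
  ∈-insertAt⁺ s p b {i} i∈ = lookup⇒∈ (trans (insertAt-punchIn s p b i) (∈⇒lookup i∈))

  ∈-insertAt-true : ∀ {m} (s : Subset m) p → p ∈ insertAt s p true
  ∈-insertAt-true s p = lookup⇒∈ (insertAt-lookup s p true)

  ∉-insertAt-false : ∀ {m} (s : Subset m) p → p ∉ insertAt s p false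
  ∉-insertAt-false s p p∈ with trans (sym (insertAt-lookup s p false)) (∈⇒lookup p∈)
  ... | ()

  ∣insertAt-false∣ : ∀ {m} (s : Subset m) p → ∣ insertAt s p false ∣ ≡ ∣ s ∣
  ∣insertAt-false∣ s           zero    = refl
  ∣insertAt-false∣ (true ∷ s)  (suc p) = cong suc (∣insertAt-false∣ s p)
  ∣insertAt-false∣ (false ∷ s) (suc p) = ∣insertAt-false∣ s p

  ∣insertAt-true∣ : ∀ {m} (s : Subset m) p → ∣ insertAt s p true ∣ ≡ suc ∣ s ∣
  ∣insertAt-true∣ s           zero    = refl
  ∣insertAt-true∣ (true ∷ s)  (suc p) = cong suc (∣insertAt-true∣ s p)
  ∣insertAt-true∣ (false ∷ s) (suc p) = ∣insertAt-true∣ s p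

  ⊆-∣∣⇒≡ : ∀ {m} {s t : Subset m} → s ⊆ t → ∣ s ∣ ≡ ∣ t ∣ → s ≡ t
  ⊆-∣∣⇒≡ {s = s} s⊆t ∣s∣≡∣t∣ = ⊆-antisym s⊆t λ {x} x∈t → decidable-stable (x ∈? s)
    (λ x∉s → ℕP.<-irrefl ∣s∣≡∣t∣ (p⊂q⇒∣p∣<∣q∣ (s⊆t , x , x∈t , x∉s)))

  remove : ∀ {m} → Subset m → Fin m → Subset m
  remove s x = updateAt s x (λ _ → false)

  ∉-remove : ∀ {m} (s : Subset m) x → x ∉ remove s x
  ∉-remove s x x∈ with trans (sym (lookup∘updateAt x s)) (∈⇒lookup x∈)
  ... | ()

  ∈-remove⁺ : ∀ {m} {s : Subset m} {x y} → y ∈ s → y ≢ x → y ∈ remove s x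
  ∈-remove⁺ {s = s} {x} {y} y∈s y≢x = lookup⇒∈ (trans (lookup∘updateAt′ y x y≢x s) (∈⇒lookup y∈s))

  ∈-remove⁻ : ∀ {m} {s : Subset m} {x y} → y ∈ remove s x → y ∈ s
  ∈-remove⁻ {s = s} {x} {y} y∈ with y Fin.≟ x
  ... | yes refl = ⊥-elim (∉-remove s x y∈)
  ... | no y≢x   = lookup⇒∈ (trans (sym (lookup∘updateAt′ y x y≢x s)) (∈⇒lookup y∈))

  remove-⊆ : ∀ {m} (s : Subset m) x → remove s x ⊆ s
  remove-⊆ s x = ∈-remove⁻

  suc∣remove∣ : ∀ {m} {s : Subset m} {x} → x ∈ s → suc ∣ remove s x ∣ ≡ ∣ s ∣
  suc∣remove∣ {s = true ∷ s}  {zero}  here       = refl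
  suc∣remove∣ {s = true ∷ s}  {suc x} (there x∈) = cong suc (suc∣remove∣ x∈)
  suc∣remove∣ {s = false ∷ s} {suc x} (there x∈) = suc∣remove∣ x∈

  remove-injective : ∀ {m} {s : Subset m} {x y} → x ∈ s → remove s x ≡ remove s y → x ≡ y
  remove-injective {s = s} {x} {y} x∈s eq with x Fin.≟ y
  ... | yes x≡y = x≡y
  ... | no x≢y  = ⊥-elim (∉-remove s x (subst (x ∈_) (sym eq) (∈-remove⁺ x∈s x≢y)))

  ⊆-remove : ∀ {m} {s t : Subset m} → s ⊆ t → suc ∣ s ∣ ≡ ∣ t ∣ → ∃ λ x → x ∈ t × s ≡ remove t x
  ⊆-remove {s = s} {t} s⊆t size with any? (λ x → (x ∈? t) ×-dec ¬? (x ∈? s))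
  ... | yes (x , x∈t , x∉s) = x , x∈t , ⊆-∣∣⇒≡ (λ y∈s → ∈-remove⁺ (s⊆t y∈s) (λ { refl → x∉s y∈s }))
                                               (ℕP.suc-injective (trans size (sym (suc∣remove∣ x∈t))))
  ... | no ∄x = ⊥-elim (ℕP.<-irrefl (sym size) (ℕ.s≤s (p⊆q⇒∣p∣≤∣q∣ {p = t} {q = s} t⊆s)))
    where
    t⊆s : t ⊆ s
    t⊆s {x} x∈t = decidable-stable (x ∈? s) (λ x∉s → ∄x (x , x∈t , x∉s))

  member : ∀ {m} (s : Subset m) → Fin ∣ s ∣ → Fin m
  member (true ∷ s)  zero    = zero
  member (true ∷ s)  (suc i) = suc (member s i)
  member (false ∷ s) i       = suc (member s i)

  member-∈ : ∀ {m} (s : Subset m) i → member s i ∈ s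
  member-∈ (true ∷ s)  zero    = here
  member-∈ (true ∷ s)  (suc i) = there (member-∈ s i)
  member-∈ (false ∷ s) i       = there (member-∈ s i)

  member-injective : ∀ {m} (s : Subset m) {i j} → member s i ≡ member s j → i ≡ j
  member-injective (true ∷ s)  {zero}  {zero}  _  = refl
  member-injective (true ∷ s)  {suc i} {suc j} eq = cong suc (member-injective s (FinP.suc-injective eq))
  member-injective (false ∷ s)                 eq = member-injective s (FinP.suc-injective eq)

  member-surjective : ∀ {m} (s : Subset m) {x} → x ∈ s → ∃ λ i → member s i ≡ x
  member-surjective (true ∷ s)  {zero}  here       = zero , refl
  member-surjective (true ∷ s)  {suc x} (there x∈) = Data.Product.map suc (cong suc) (member-surjective s x∈)
  member-surjective (false ∷ s) {suc x} (there x∈) = Data.Product.map id (cong suc) (member-surjective s x∈)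

open SubsetLemmas

module _ {n} {k : ℕ} {G : Graph n} where

  KWalk-snoc : ∀ {τ τ' τ'' l} → KWalk k G τ τ' l → (σ : Subset n) → IsKClique (suc k) G σ →
               IsKClique k G τ' → IsKClique k G τ'' → τ' ⊆ σ → τ'' ⊆ σ → KWalk k G τ τ'' (suc l)
  KWalk-snoc nil                       σ σ-cl τ'-cl τ''-cl τ'⊆σ τ''⊆σ = cons σ σ-cl τ'-cl τ''-cl τ'⊆σ τ''⊆σ nil
  KWalk-snoc (cons σ₁ σ₁-cl a b a⊆ b⊆ w) σ σ-cl τ'-cl τ''-cl τ'⊆σ τ''⊆σ =
    cons σ₁ σ₁-cl a b a⊆ b⊆ (KWalk-snoc w σ σ-cl τ'-cl τ''-cl τ'⊆σ τ''⊆σ)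

  KWalk-reverse : ∀ {τ τ' l} → KWalk k G τ τ' l → KWalk k G τ' τ l
  KWalk-reverse nil                          = nil
  KWalk-reverse (cons σ σ-cl a b a⊆σ b⊆σ w) = KWalk-snoc (KWalk-reverse w) σ σ-cl b a b⊆σ a⊆σ

  KWalk-0⇒≡ : ∀ {τ τ'} → KWalk k G τ τ' 0 → τ ≡ τ'
  KWalk-0⇒≡ nil = refl

  IsKDist-sym : ∀ {τ τ' d} → IsKDist k G τ τ' d → IsKDist k G τ' τ d
  IsKDist-sym (w , minimal) = KWalk-reverse w , λ l w' → minimal l (KWalk-reverse w')

  IsKDist-self : ∀ {τ d} → IsKDist k G τ τ d → d ≡ 0
  IsKDist-self (_ , minimal) = ℕP.n≤0⇒n≡0 (minimal 0 nil)

-- Adjoining a vertex to a k-tree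

module Extension (k : ℕ) {m} {H : Graph m} (C : Subset m) (C-cl : IsKClique k H C)
                 (p : Fin (suc m)) {G : Graph (suc m)}
                 (G-old : ∀ i j → G (punchIn p i) (punchIn p j) ≡ H i j)
                 (G-newˡ : ∀ i → G p (punchIn p i) ≡ lookup C i)
                 (G-newʳ : ∀ i → G (punchIn p i) p ≡ lookup C i) where

  open import Data.Vec using (insertAt; removeAt)
  open import Data.Vec.Properties using (insertAt-lookup; removeAt-insertAt; insertAt-removeAt)

  vertex-cases : ∀ v → v ≡ p ⊎ ∃ λ i → v ≡ punchIn p i
  vertex-cases v with p Fin.≟ v
  ... | yes p≡v = inj₁ (sym p≡v)
  ... | no p≢v  = inj₂ (punchOut p≢v , sym (punchIn-punchOut p≢v))

  lift : Subset m → Subset (suc m)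
  lift s = insertAt s p false

  Ĉ : Subset (suc m)
  Ĉ = insertAt C p true

  element : Fin k → Fin m
  element x = member C (Fin.cast (sym (proj₁ C-cl)) x)

  ν : Fin k → Subset (suc m)
  ν x = insertAt (remove C (element x)) p true

  element-∈ : ∀ x → element x ∈ C
  element-∈ x = member-∈ C _

  element-injective : ∀ {x y} → element x ≡ element y → x ≡ y
  element-injective {x} {y} eq = begin
    x                                         ≡⟨ FinP.cast-involutive (proj₁ C-cl) (sym (proj₁ C-cl)) x ⟨
    Fin.cast (proj₁ C-cl) (Fin.cast _ x)      ≡⟨ cong (Fin.cast (proj₁ C-cl)) (member-injective C eq) ⟩
    Fin.cast (proj₁ C-cl) (Fin.cast _ y)      ≡⟨ FinP.cast-involutive (proj₁ C-cl) (sym (proj₁ C-cl)) y ⟩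
    y                                         ∎

  element-surjective : ∀ {v} → v ∈ C → ∃ λ x → element x ≡ v
  element-surjective v∈C with member-surjective C v∈C
  ... | i , refl = Fin.cast (proj₁ C-cl) i , cong (member C) (FinP.cast-involutive (sym (proj₁ C-cl)) (proj₁ C-cl) i)

  lift-isClique : ∀ {s} → IsClique H s → IsClique G (lift s)
  lift-isClique {s} s-cl i j i∈ j∈ i≢j with vertex-cases i | vertex-cases j
  ... | inj₁ refl | _         = ⊥-elim (∉-insertAt-false s p i∈)
  ... | inj₂ _    | inj₁ refl = ⊥-elim (∉-insertAt-false s p j∈)
  ... | inj₂ (i' , refl) | inj₂ (j' , refl) =
    trans (G-old i' j') (s-cl i' j' (∈-insertAt⁻ s p false i∈) (∈-insertAt⁻ s p false j∈) (i≢j ∘ cong (punchIn p)))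

  lift-isKClique : ∀ {j s} → IsKClique j H s → IsKClique j G (lift s)
  lift-isKClique {s = s} (∣s∣≡j , s-cl) = trans (∣insertAt-false∣ s p) ∣s∣≡j , lift-isClique s-cl

  unlift-isClique : ∀ {s} → IsClique G (lift s) → IsClique H s
  unlift-isClique {s} cl i j i∈ j∈ i≢j = trans (sym (G-old i j))
    (cl (punchIn p i) (punchIn p j) (∈-insertAt⁺ s p false i∈) (∈-insertAt⁺ s p false j∈)
        (i≢j ∘ FinP.punchIn-injective p i j))

  cone-isClique : ∀ {s} → s ⊆ C → IsClique G (insertAt s p true)
  cone-isClique {s} s⊆C i j i∈ j∈ i≢j with vertex-cases i | vertex-cases j
  ... | inj₁ refl        | inj₁ refl        = ⊥-elim (i≢j refl)
  ... | inj₁ refl        | inj₂ (j' , refl) = trans (G-newˡ j') (∈⇒lookup (s⊆C (∈-insertAt⁻ s p true j∈)))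
  ... | inj₂ (i' , refl) | inj₁ refl        = trans (G-newʳ i') (∈⇒lookup (s⊆C (∈-insertAt⁻ s p true i∈)))
  ... | inj₂ (i' , refl) | inj₂ (j' , refl) = trans (G-old i' j')
    (proj₂ C-cl i' j' (s⊆C (∈-insertAt⁻ s p true i∈)) (s⊆C (∈-insertAt⁻ s p true j∈)) (i≢j ∘ cong (punchIn p)))

  ν-isKClique : ∀ x → IsKClique k G (ν x)
  ν-isKClique x = trans (∣insertAt-true∣ _ p) (trans (suc∣remove∣ (element-∈ x)) (proj₁ C-cl)) ,
                  cone-isClique (remove-⊆ C (element x))

  Ĉ-isKClique : IsKClique (suc k) G Ĉ
  Ĉ-isKClique = trans (∣insertAt-true∣ C p) (cong suc (proj₁ C-cl)) , cone-isClique (λ i∈ → i∈)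

  insertAt-⊆ : ∀ {s t : Subset m} {b b'} → s ⊆ t → (b ≡ true → b' ≡ true) → insertAt s p b ⊆ insertAt t p b'
  insertAt-⊆ {s} {t} {b} {b'} s⊆t b⇒b' {v} v∈ with vertex-cases v
  ... | inj₁ refl        = lookup⇒∈ (trans (insertAt-lookup t p b') (b⇒b' (trans (sym (insertAt-lookup s p b)) (∈⇒lookup v∈))))
  ... | inj₂ (i , refl)  = ∈-insertAt⁺ t p b' (s⊆t (∈-insertAt⁻ s p b v∈))

  insertAt-⊆⁻ : ∀ {s t : Subset m} {b b'} → insertAt s p b ⊆ insertAt t p b' → s ⊆ t
  insertAt-⊆⁻ {s} {t} {b} {b'} ⊆ i∈ = ∈-insertAt⁻ t p b' (⊆ (∈-insertAt⁺ s p b i∈))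

  insertAt-injective : ∀ {s t : Subset m} {b b'} → insertAt s p b ≡ insertAt t p b' → s ≡ t
  insertAt-injective {s} {t} {b} {b'} eq =
    trans (sym (removeAt-insertAt s p b)) (trans (cong (λ u → removeAt u p) eq) (removeAt-insertAt t p b'))

  ν⊆Ĉ : ∀ x → ν x ⊆ Ĉ
  ν⊆Ĉ x = insertAt-⊆ (remove-⊆ C (element x)) id

  lift-C⊆Ĉ : lift C ⊆ Ĉ
  lift-C⊆Ĉ = insertAt-⊆ id (λ ())

  lift-⊆ : ∀ {s t} → s ⊆ t → lift s ⊆ lift t
  lift-⊆ s⊆t = insertAt-⊆ s⊆t id

  ν⊈lift : ∀ {x s} → ν x ⊆ lift s → ⊥
  ν⊈lift {x} {s} ν⊆ = ∉-insertAt-false s p (ν⊆ (∈-insertAt-true _ p))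

  ν≢lift : ∀ {x s} → ν x ≢ lift s
  ν≢lift {x} {s} eq = ν⊈lift (subst (ν x ⊆_) eq id)

  ν-injective : ∀ {x y} → ν x ≡ ν y → x ≡ y
  ν-injective eq = element-injective (remove-injective (element-∈ _) (insertAt-injective eq))

  split-at-p : ∀ (t : Subset (suc m)) → t ≡ insertAt (removeAt t p) p (lookup t p)
  split-at-p t = sym (insertAt-removeAt t p)

  cliques-without-p : ∀ {j t} → IsKClique j G t → lookup t p ≡ false → ∃ λ s → IsKClique j H s × t ≡ lift s
  cliques-without-p {j} {t} (∣t∣≡j , t-cl) p∉t = removeAt t p ,
    (trans (sym (∣insertAt-false∣ (removeAt t p) p)) (trans (cong ∣_∣ (sym t≡)) ∣t∣≡j) ,
     unlift-isClique (subst (IsClique G) t≡ t-cl)) , t≡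
    where
    t≡ : t ≡ lift (removeAt t p)
    t≡ = trans (split-at-p t) (cong (insertAt (removeAt t p) p) p∉t)

  cliques-with-p : ∀ {j t} → IsKClique j G t → lookup t p ≡ true → removeAt t p ⊆ C × j ≡ suc ∣ removeAt t p ∣
  cliques-with-p {j} {t} (∣t∣≡j , t-cl) p∈t =
    ⊆C , trans (sym ∣t∣≡j) (trans (cong ∣_∣ t≡) (∣insertAt-true∣ (removeAt t p) p))
    where
    t≡ : t ≡ insertAt (removeAt t p) p true
    t≡ = trans (split-at-p t) (cong (insertAt (removeAt t p) p) p∈t)
    ⊆C : removeAt t p ⊆ C
    ⊆C {i} i∈ = lookup⇒∈ (trans (sym (G-newˡ i))
      (t-cl p (punchIn p i) (lookup⇒∈ p∈t) (subst (punchIn p i ∈_) (sym t≡) (∈-insertAt⁺ _ p true i∈))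
            (punchInᵢ≢i p i ∘ sym)))

  kClique-cases : ∀ {t} → IsKClique k G t → (∃ λ s → IsKClique k H s × t ≡ lift s) ⊎ (∃ λ x → t ≡ ν x)
  kClique-cases {t} t-cl with lookup t p in p∈t
  ... | false = inj₁ (cliques-without-p t-cl p∈t)
  ... | true with cliques-with-p t-cl p∈t
  ...   | ⊆C , k≡ with ⊆-remove ⊆C (trans (sym k≡) (sym (proj₁ C-cl)))
  ...     | v , v∈C , ≡remove with element-surjective v∈C
  ...       | x , refl = inj₂ (x , trans (split-at-p t) (cong₂ (λ u b → insertAt u p b) ≡remove p∈t))

  kClique⁺-cases : ∀ {σ} → IsKClique (suc k) G σ → (∃ λ s → IsKClique (suc k) H s × σ ≡ lift s) ⊎ σ ≡ Ĉ
  kClique⁺-cases {σ} σ-cl with lookup σ p in p∈σ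
  ... | false = inj₁ (cliques-without-p σ-cl p∈σ)
  ... | true with cliques-with-p σ-cl p∈σ
  ...   | ⊆C , k≡ = inj₂ (trans (split-at-p σ) (cong₂ (λ u b → insertAt u p b)
                           (⊆-∣∣⇒≡ ⊆C (trans (sym (ℕP.suc-injective k≡)) (sym (proj₁ C-cl)))) p∈σ))

  kClique⊆Ĉ-cases : ∀ {τ} → IsKClique k G τ → τ ⊆ Ĉ → τ ≡ lift C ⊎ ∃ λ x → τ ≡ ν x
  kClique⊆Ĉ-cases τ-cl τ⊆Ĉ with kClique-cases τ-cl
  ... | inj₂ new                = inj₂ new
  ... | inj₁ (s , s-cl , refl)  = inj₁ (cong lift (⊆-∣∣⇒≡ (insertAt-⊆⁻ τ⊆Ĉ) (trans (proj₁ s-cl) (sym (proj₁ C-cl)))))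

  contract : Subset (suc m) → Subset m
  contract t with lookup t p
  ... | true  = C
  ... | false = removeAt t p

  contract-lift : ∀ s → contract (lift s) ≡ s
  contract-lift s rewrite insertAt-lookup s p false = removeAt-insertAt s p false

  contract-ν : ∀ x → contract (ν x) ≡ C
  contract-ν x rewrite insertAt-lookup (remove C (element x)) p true = refl

  contract-⊆Ĉ : ∀ {τ} → IsKClique k G τ → τ ⊆ Ĉ → contract τ ≡ C
  contract-⊆Ĉ τ-cl τ⊆Ĉ with kClique⊆Ĉ-cases τ-cl τ⊆Ĉ
  ... | inj₁ refl       = contract-lift C
  ... | inj₂ (x , refl) = contract-ν x

  lift-walk : ∀ {s t l} → KWalk k H s t l → KWalk k G (lift s) (lift t) l
  lift-walk nil                          = nil
  lift-walk (cons σ σ-cl a b a⊆σ b⊆σ w) =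
    cons (lift σ) (lift-isKClique σ-cl) (lift-isKClique a) (lift-isKClique b) (lift-⊆ a⊆σ) (lift-⊆ b⊆σ) (lift-walk w)

  contract-walk : ∀ {τ τ' l} → KWalk k G τ τ' l → ∃ λ l' → l' ℕ.≤ l × KWalk k H (contract τ) (contract τ') l'
  contract-walk nil = 0 , ℕ.z≤n , nil
  contract-walk (cons σ σ-cl a b a⊆σ b⊆σ w) with contract-walk w | kClique⁺-cases σ-cl
  ... | l' , l'≤ , w' | inj₂ refl = l' , ℕP.m≤n⇒m≤1+n l'≤ ,
        subst (λ τ → KWalk k H τ _ l') (trans (contract-⊆Ĉ b b⊆σ) (sym (contract-⊆Ĉ a a⊆σ))) w'
  ... | l' , l'≤ , w' | inj₁ (σ' , σ'-cl , refl) with kClique-cases a | kClique-cases b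
  ...   | inj₂ (x , refl) | _               = ⊥-elim (ν⊈lift a⊆σ)
  ...   | inj₁ _          | inj₂ (x , refl) = ⊥-elim (ν⊈lift b⊆σ)
  ...   | inj₁ (s₁ , s₁-cl , refl) | inj₁ (s₂ , s₂-cl , refl) = suc l' , ℕ.s≤s l'≤ ,
        subst (λ τ → KWalk k H τ _ (suc l')) (sym (contract-lift s₁))
          (cons σ' σ'-cl s₁-cl s₂-cl (insertAt-⊆⁻ a⊆σ) (insertAt-⊆⁻ b⊆σ) (subst (λ τ → KWalk k H τ _ l') (contract-lift s₂) w'))

  IsKDist-unlift : ∀ {s t d} → IsKDist k G (lift s) (lift t) d → IsKDist k H s t d
  IsKDist-unlift {s} {t} {d} (w , minimal) with contract-walk w
  ... | l' , l'≤d , w' = subst (KWalk k H s t) l'≡d wH , λ l w₂ → minimal l (lift-walk w₂)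
    where
    wH : KWalk k H s t l'
    wH = subst₂ (λ a b → KWalk k H a b l') (contract-lift s) (contract-lift t) w'
    l'≡d : l' ≡ d
    l'≡d = ℕP.≤-antisym l'≤d (minimal l' (lift-walk wH))

  -- A k-walk from ν x leaves the new k-cliques only through Ĉ, and does so at the cost of one step.
  IsKDist-ν-lift : ∀ {x t d d'} → IsKDist k G (ν x) (lift t) d → IsKDist k G (lift C) (lift t) d' → d ≡ suc d'
  IsKDist-ν-lift {x} {t} {d} {d'} (w , minimal) (w' , minimal') = ℕP.≤-antisym (minimal (suc d') via-Ĉ) (lower-bound d x w)
    where
    via-Ĉ : KWalk k G (ν x) (lift t) (suc d')
    via-Ĉ = cons Ĉ Ĉ-isKClique (ν-isKClique x) (lift-isKClique C-cl) (ν⊆Ĉ x) lift-C⊆Ĉ w'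
    lower-bound : ∀ l y → KWalk k G (ν y) (lift t) l → suc d' ℕ.≤ l
    lower-bound zero    y w₀ = ⊥-elim (ν≢lift (KWalk-0⇒≡ w₀))
    lower-bound (suc l) y (cons σ σ-cl a b a⊆σ b⊆σ rest) with kClique⁺-cases σ-cl
    ... | inj₁ (σ' , _ , refl) = ⊥-elim (ν⊈lift a⊆σ)
    ... | inj₂ refl with kClique⊆Ĉ-cases b b⊆σ
    ...   | inj₁ refl       = ℕ.s≤s (minimal' l rest)
    ...   | inj₂ (z , refl) = ℕP.m≤n⇒m≤1+n (lower-bound l z rest)

  IsKDist-lift-ν : ∀ {x t d d'} → IsKDist k G (lift t) (ν x) d → IsKDist k G (lift t) (lift C) d' → d ≡ suc d'
  IsKDist-lift-ν dist dist' = IsKDist-ν-lift (IsKDist-sym dist) (IsKDist-sym dist')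

  IsKDist-ν-ν : ∀ {x y d} → x ≢ y → IsKDist k G (ν x) (ν y) d → d ≡ 1
  IsKDist-ν-ν {d = zero}        x≢y (w , _)       = ⊥-elim (x≢y (ν-injective (KWalk-0⇒≡ w)))
  IsKDist-ν-ν {d = suc zero}    x≢y _             = refl
  IsKDist-ν-ν {x} {y} {suc (suc d)} x≢y (_ , minimal)
    with minimal 1 (cons Ĉ Ĉ-isKClique (ν-isKClique x) (ν-isKClique y) (ν⊆Ĉ x) (ν⊆Ĉ y) nil)
  ... | ℕ.s≤s ()

module _ {a b : ℕ} where

  open import Data.Vec.Functional using (_++_)
  open import Data.Vec.Functional.Properties using (lookup-++ˡ; lookup-++ʳ)
  open import Data.Fin.Properties using (join-splitAt)

  ↑-elim : (P : Fin (a ℕ.+ b) → Set) → (∀ i → P (i ↑ˡ b)) → (∀ x → P (a ↑ʳ x)) → ∀ i → P i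
  ↑-elim P old new i = subst P (join-splitAt a b i) (cases (Fin.splitAt a i))
    where
    cases : ∀ s → P (Fin.join a b s)
    cases (inj₁ i) = old i
    cases (inj₂ x) = new x

  block : Mat a a → Mat a b → Mat b a → Mat b b → Matrix (a ℕ.+ b)
  block A B C D = (λ i → A i ++ B i) ++ (λ x → C x ++ D x)

  module _ (A : Mat a a) (B : Mat a b) (C : Mat b a) (D : Mat b b) where

    block-↑ˡ↑ˡ : ∀ i j → block A B C D (i ↑ˡ b) (j ↑ˡ b) ≡ A i j
    block-↑ˡ↑ˡ i j = trans (cong-app (lookup-++ˡ (λ i → A i ++ B i) _ i) (j ↑ˡ b)) (lookup-++ˡ (A i) (B i) j)

    block-↑ˡ↑ʳ : ∀ i y → block A B C D (i ↑ˡ b) (a ↑ʳ y) ≡ B i y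
    block-↑ˡ↑ʳ i y = trans (cong-app (lookup-++ˡ (λ i → A i ++ B i) _ i) (a ↑ʳ y)) (lookup-++ʳ (A i) (B i) y)

    block-↑ʳ↑ˡ : ∀ x j → block A B C D (a ↑ʳ x) (j ↑ˡ b) ≡ C x j
    block-↑ʳ↑ˡ x j = trans (cong-app (lookup-++ʳ (λ i → A i ++ B i) _ x) (j ↑ˡ b)) (lookup-++ˡ (C x) (D x) j)

    block-↑ʳ↑ʳ : ∀ x y → block A B C D (a ↑ʳ x) (a ↑ʳ y) ≡ D x y
    block-↑ʳ↑ʳ x y = trans (cong-app (lookup-++ʳ (λ i → A i ++ B i) _ x) (a ↑ʳ y)) (lookup-++ʳ (C x) (D x) y)

δ-↑ˡ↑ˡ : ∀ {a} b (i j : Fin a) → δ (i ↑ˡ b) (j ↑ˡ b) ≡ δ i j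
δ-↑ˡ↑ˡ b zero    zero    = refl
δ-↑ˡ↑ˡ b zero    (suc j) = refl
δ-↑ˡ↑ˡ b (suc i) zero    = refl
δ-↑ˡ↑ˡ b (suc i) (suc j) = δ-↑ˡ↑ˡ b i j

δ-↑ˡ↑ʳ : ∀ {a b} (i : Fin a) (y : Fin b) → δ (i ↑ˡ b) (a ↑ʳ y) ≡ + 0
δ-↑ˡ↑ʳ zero    y = refl
δ-↑ˡ↑ʳ (suc i) y = δ-↑ˡ↑ʳ i y

δ-↑ʳ↑ˡ : ∀ {a b} (x : Fin b) (j : Fin a) → δ (a ↑ʳ x) (j ↑ˡ b) ≡ + 0
δ-↑ʳ↑ˡ x zero    = refl
δ-↑ʳ↑ˡ x (suc j) = δ-↑ʳ↑ˡ x j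

δ-↑ʳ↑ʳ : ∀ a {b} (x y : Fin b) → δ (a ↑ʳ x) (a ↑ʳ y) ≡ δ x y
δ-↑ʳ↑ʳ zero    x y = refl
δ-↑ʳ↑ʳ (suc a) x y = δ-↑ʳ↑ʳ a x y

module _ {a b : ℕ} where

  lowerBlock : Mat a a → Mat b a → Matrix (a ℕ.+ b)
  lowerBlock A C = block A (λ _ _ → + 0) C δ

  module _ (A : Mat a a) (C : Mat b a) {n} (X : Mat (a ℕ.+ b) n) where

    lowerBlock-·-↑ˡ : ∀ i c → (lowerBlock A C · X) (i ↑ˡ b) c ≡ sum (λ l → A i l * X (l ↑ˡ b) c)
    lowerBlock-·-↑ˡ i c = begin
      sum (λ l → lowerBlock A C (i ↑ˡ b) l * X l c)
        ≡⟨ sum-↑ {a} {b} (λ l → lowerBlock A C (i ↑ˡ b) l * X l c) ⟩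
      sum (λ l → lowerBlock A C (i ↑ˡ b) (l ↑ˡ b) * X (l ↑ˡ b) c) + sum (λ y → lowerBlock A C (i ↑ˡ b) (a ↑ʳ y) * X (a ↑ʳ y) c)
        ≡⟨ cong₂ _+_ (sum-cong-≗ (λ l → cong (_* X (l ↑ˡ b) c) (block-↑ˡ↑ˡ A _ C δ i l)))
                     (sum-zero (λ y → cong (_* X (a ↑ʳ y) c) (block-↑ˡ↑ʳ A _ C δ i y))) ⟩
      sum (λ l → A i l * X (l ↑ˡ b) c) + + 0
        ≡⟨ ℤP.+-identityʳ (sum (λ l → A i l * X (l ↑ˡ b) c)) ⟩
      sum (λ l → A i l * X (l ↑ˡ b) c) ∎

    lowerBlock-·-↑ʳ : ∀ x c → (lowerBlock A C · X) (a ↑ʳ x) c ≡ sum (λ l → C x l * X (l ↑ˡ b) c) + X (a ↑ʳ x) c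
    lowerBlock-·-↑ʳ x c = begin
      sum (λ l → lowerBlock A C (a ↑ʳ x) l * X l c)
        ≡⟨ sum-↑ {a} {b} (λ l → lowerBlock A C (a ↑ʳ x) l * X l c) ⟩
      sum (λ l → lowerBlock A C (a ↑ʳ x) (l ↑ˡ b) * X (l ↑ˡ b) c) + sum (λ y → lowerBlock A C (a ↑ʳ x) (a ↑ʳ y) * X (a ↑ʳ y) c)
        ≡⟨ cong₂ _+_ (sum-cong-≗ (λ l → cong (_* X (l ↑ˡ b) c) (block-↑ʳ↑ˡ A _ C δ x l)))
                     (trans (sum-cong-≗ (λ y → cong (_* X (a ↑ʳ y) c) (block-↑ʳ↑ʳ A _ C δ x y))) (sum-δˡ x (λ y → X (a ↑ʳ y) c))) ⟩
      sum (λ l → C x l * X (l ↑ˡ b) c) + X (a ↑ʳ x) c ∎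

  lowerBlock-· : ∀ (A A' : Mat a a) (C C' : Mat b a) →
                 lowerBlock A C · lowerBlock A' C' ≐ lowerBlock (A · A') (λ x j → (C · A') x j + C' x j)
  lowerBlock-· A A' C C' = ↑-elim (λ r → ∀ c → (L · L') r c ≡ L'' r c)
    (λ i → ↑-elim (λ c → (L · L') (i ↑ˡ b) c ≡ L'' (i ↑ˡ b) c)
      (λ j → begin
        (L · L') (i ↑ˡ b) (j ↑ˡ b)                  ≡⟨ lowerBlock-·-↑ˡ A C L' i (j ↑ˡ b) ⟩
        sum (λ l → A i l * L' (l ↑ˡ b) (j ↑ˡ b))    ≡⟨ sum-cong-≗ (λ l → cong (A i l *_) (block-↑ˡ↑ˡ A' _ C' δ l j)) ⟩
        (A · A') i j                                ≡⟨ block-↑ˡ↑ˡ (A · A') _ C'' δ i j ⟨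
        L'' (i ↑ˡ b) (j ↑ˡ b)                       ∎)
      (λ y → begin
        (L · L') (i ↑ˡ b) (a ↑ʳ y)                  ≡⟨ lowerBlock-·-↑ˡ A C L' i (a ↑ʳ y) ⟩
        sum (λ l → A i l * L' (l ↑ˡ b) (a ↑ʳ y))    ≡⟨ sum-zero (λ l → trans (cong (A i l *_) (block-↑ˡ↑ʳ A' _ C' δ l y))
                                                                               (ℤP.*-zeroʳ (A i l))) ⟩
        + 0                                         ≡⟨ block-↑ˡ↑ʳ (A · A') _ C'' δ i y ⟨
        L'' (i ↑ˡ b) (a ↑ʳ y)                       ∎))
    (λ x → ↑-elim (λ c → (L · L') (a ↑ʳ x) c ≡ L'' (a ↑ʳ x) c)
      (λ j → begin
        (L · L') (a ↑ʳ x) (j ↑ˡ b)                                         ≡⟨ lowerBlock-·-↑ʳ A C L' x (j ↑ˡ b) ⟩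
        sum (λ l → C x l * L' (l ↑ˡ b) (j ↑ˡ b)) + L' (a ↑ʳ x) (j ↑ˡ b)
          ≡⟨ cong₂ _+_ (sum-cong-≗ (λ l → cong (C x l *_) (block-↑ˡ↑ˡ A' _ C' δ l j))) (block-↑ʳ↑ˡ A' _ C' δ x j) ⟩
        C'' x j                                                            ≡⟨ block-↑ʳ↑ˡ (A · A') _ C'' δ x j ⟨
        L'' (a ↑ʳ x) (j ↑ˡ b)                                              ∎)
      (λ y → begin
        (L · L') (a ↑ʳ x) (a ↑ʳ y)                                         ≡⟨ lowerBlock-·-↑ʳ A C L' x (a ↑ʳ y) ⟩
        sum (λ l → C x l * L' (l ↑ˡ b) (a ↑ʳ y)) + L' (a ↑ʳ x) (a ↑ʳ y)
          ≡⟨ cong₂ _+_ (sum-zero (λ l → trans (cong (C x l *_) (block-↑ˡ↑ʳ A' _ C' δ l y)) (ℤP.*-zeroʳ (C x l))))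
                       (block-↑ʳ↑ʳ A' _ C' δ x y) ⟩
        + 0 + δ x y                                                        ≡⟨ ℤP.+-identityˡ (δ x y) ⟩
        δ x y                                                              ≡⟨ block-↑ʳ↑ʳ (A · A') _ C'' δ x y ⟨
        L'' (a ↑ʳ x) (a ↑ʳ y)                                              ∎))
    where
    L L' L'' : Matrix (a ℕ.+ b)
    L   = lowerBlock A C
    L'  = lowerBlock A' C'
    C'' : Mat b a
    C'' x j = (C · A') x j + C' x j
    L'' = lowerBlock (A · A') C''

lowerBlock-δ : ∀ {a b} {A : Mat a a} {C : Mat b a} → A ≐ δ → (∀ x j → C x j ≡ + 0) → lowerBlock A C ≐ δ
lowerBlock-δ {a} {b} {A} {C} A≐δ C≐0 = ↑-elim (λ r → ∀ c → lowerBlock A C r c ≡ δ r c)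
  (λ i → ↑-elim (λ c → lowerBlock A C (i ↑ˡ b) c ≡ δ (i ↑ˡ b) c)
    (λ j → trans (block-↑ˡ↑ˡ A _ C δ i j) (trans (A≐δ i j) (sym (δ-↑ˡ↑ˡ b i j))))
    (λ y → trans (block-↑ˡ↑ʳ A _ C δ i y) (sym (δ-↑ˡ↑ʳ i y))))
  (λ x → ↑-elim (λ c → lowerBlock A C (a ↑ʳ x) c ≡ δ (a ↑ʳ x) c)
    (λ j → trans (block-↑ʳ↑ˡ A _ C δ x j) (trans (C≐0 x j) (sym (δ-↑ʳ↑ˡ x j))))
    (λ y → trans (block-↑ʳ↑ʳ A _ C δ x y) (sym (δ-↑ʳ↑ʳ a x y))))

-- The normal form of the k-distance matrix

-- k · s, by recursion on s so that suc (newCliques k (suc s)) unfolds to suc (newCliques k s) + k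
newCliques : ℕ → ℕ → ℕ
newCliques k zero    = 0
newCliques k (suc s) = newCliques k s ℕ.+ k

canonical : (k s : ℕ) → Matrix (suc (newCliques k s))
canonical k zero    = λ _ _ → + 0
canonical k (suc s) = block (canonical k s) (λ i _ → δ zero i) (λ _ j → δ zero j) (λ x y → - + 1 - δ x y)

toℤ : ∀ {a b} → (Fin a → Fin b → ℕ) → Mat a b
toℤ D i j = + D i j

record NormalForm (k : ℕ) {m} (G : Graph m) (s : ℕ) : Set where
  field
    clique      : Fin (suc (newCliques k s)) → Subset m
    enumeration : IsKCliqueEnumeration k G (suc (newCliques k s)) clique
    P P⁻¹       : Matrix (suc (newCliques k s))
    P⁻¹·P       : P⁻¹ · P ≐ δ
    P·P⁻¹       : P · P⁻¹ ≐ δ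
    P-rowSum    : ∀ i → sum (P i) ≡ δ zero i
    P·D·Pᵀ      : ∀ D → (∀ a b → IsKDist k G (clique a) (clique b) (D a b)) → P · (toℤ D · P ᵀ) ≐ canonical k s

normalForm-base : ∀ {k} {G : Graph k} → (∀ i j → G i j ≡ not ⌊ i Fin.≟ j ⌋) → NormalForm k G 0
normalForm-base {k} {G} complete = record
  { clique      = λ _ → ⊤
  ; enumeration = (λ _ → ∣⊤∣≡n k , ⊤-isClique) , (λ { zero zero _ → refl }) ,
                  λ t t-cl → zero , sym (∣p∣≡n⇒p≡⊤ (proj₁ t-cl))
  ; P           = δ
  ; P⁻¹         = δ
  ; P⁻¹·P       = ·-identityˡ δ
  ; P·P⁻¹       = ·-identityˡ δ
  ; P-rowSum    = λ { zero → refl }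
  ; P·D·Pᵀ      = λ D dist → λ { zero zero → cong (λ d → + 1 * (+ d * + 1 + + 0) + + 0) (IsKDist-self (dist zero zero)) }
  }
  where
  ⊤-isClique : IsClique G ⊤
  ⊤-isClique i j _ _ i≢j with i Fin.≟ j | complete i j
  ... | yes i≡j | _     = ⊥-elim (i≢j i≡j)
  ... | no _    | Gij   = Gij

module NormalFormStep {k m s} {H : Graph m} (NF : NormalForm k H s)
                      (C : Subset m) (C-cl : IsKClique k H C) (p : Fin (suc m)) {G : Graph (suc m)}
                      (G-old : ∀ i j → G (punchIn p i) (punchIn p j) ≡ H i j)
                      (G-newˡ : ∀ i → G p (punchIn p i) ≡ lookup C i)
                      (G-newʳ : ∀ i → G (punchIn p i) p ≡ lookup C i) where

  open import Data.Vec.Functional using (_++_)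
  open import Data.Vec.Functional.Properties using (lookup-++ˡ; lookup-++ʳ)
  open NormalForm NF
  open Extension k C C-cl p {G} G-old G-newˡ G-newʳ

  N : ℕ
  N = suc (newCliques k s)

  old : Fin N → Fin (N ℕ.+ k)
  old i = i ↑ˡ k

  new : Fin k → Fin (N ℕ.+ k)
  new x = N ↑ʳ x

  c : Fin N
  c = proj₁ (proj₂ (proj₂ enumeration) C C-cl)

  clique-c : clique c ≡ C
  clique-c = proj₂ (proj₂ (proj₂ enumeration) C C-cl)

  clique' : Fin (N ℕ.+ k) → Subset (suc m)
  clique' = (lift ∘ clique) ++ ν

  clique'-old : ∀ i → clique' (old i) ≡ lift (clique i)
  clique'-old = lookup-++ˡ (lift ∘ clique) ν

  clique'-new : ∀ x → clique' (new x) ≡ ν x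
  clique'-new = lookup-++ʳ (lift ∘ clique) ν

  enumeration' : IsKCliqueEnumeration k G (N ℕ.+ k) clique'
  enumeration' = isKClique , injective , surjective
    where
    isKClique : ∀ a → IsKClique k G (clique' a)
    isKClique = ↑-elim _ (λ i → subst (IsKClique k G) (sym (clique'-old i)) (lift-isKClique (proj₁ enumeration i)))
                         (λ x → subst (IsKClique k G) (sym (clique'-new x)) (ν-isKClique x))
    injective : ∀ a b → clique' a ≡ clique' b → a ≡ b
    injective = ↑-elim _
      (λ i → ↑-elim _
        (λ j eq → cong old (proj₁ (proj₂ enumeration) i j (insertAt-injective (trans (sym (clique'-old i)) (trans eq (clique'-old j))))))
        (λ y eq → ⊥-elim (ν≢lift (sym (trans (sym (clique'-old i)) (trans eq (clique'-new y)))))))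
      (λ x → ↑-elim _
        (λ j eq → ⊥-elim (ν≢lift (trans (sym (clique'-new x)) (trans eq (clique'-old j)))))
        (λ y eq → cong new (ν-injective (trans (sym (clique'-new x)) (trans eq (clique'-new y))))))
    surjective : ∀ t → IsKClique k G t → ∃ λ a → clique' a ≡ t
    surjective t t-cl with kClique-cases t-cl
    ... | inj₂ (x , refl)        = new x , clique'-new x
    ... | inj₁ (s , s-cl , refl) with proj₂ (proj₂ enumeration) s s-cl
    ...   | i , clique-i≡s = old i , trans (clique'-old i) (cong lift clique-i≡s)

  E : Mat k N
  E x j = - δ c j

  F : Mat k N
  F x j = P⁻¹ c j

  P' P'⁻¹ : Matrix (N ℕ.+ k)
  P'   = lowerBlock P E
  P'⁻¹ = lowerBlock P⁻¹ F

  P'⁻¹·P' : P'⁻¹ · P' ≐ δ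
  P'⁻¹·P' i j = trans (lowerBlock-· P⁻¹ P F E i j) (lowerBlock-δ P⁻¹·P (λ x j → begin
    sum (λ l → P⁻¹ c l * P l j) - δ c j  ≡⟨ cong (_- δ c j) (P⁻¹·P c j) ⟩
    δ c j - δ c j                         ≡⟨ ℤP.+-inverseʳ (δ c j) ⟩
    + 0                                   ∎) i j)

  P'·P'⁻¹ : P' · P'⁻¹ ≐ δ
  P'·P'⁻¹ i j = trans (lowerBlock-· P P⁻¹ E F i j) (lowerBlock-δ P·P⁻¹ (λ x j → begin
    sum (λ l → - δ c l * P⁻¹ l j) + P⁻¹ c j  ≡⟨ cong (_+ P⁻¹ c j) (sum-neg-δ c (λ l → P⁻¹ l j)) ⟩
    - P⁻¹ c j + P⁻¹ c j                       ≡⟨ ℤP.+-inverseˡ (P⁻¹ c j) ⟩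
    + 0                                       ∎) i j)

  P'-rowSum : ∀ r → sum (P' r) ≡ δ zero r
  P'-rowSum = ↑-elim _
    (λ i → begin
      sum (P' (old i))                                            ≡⟨ sum-↑ {N} {k} (P' (old i)) ⟩
      sum (λ l → P' (old i) (old l)) + sum (λ y → P' (old i) (new y))
                                                                  ≡⟨ cong₂ _+_ (sum-cong-≗ (block-↑ˡ↑ˡ P _ E δ i))
                                                                               (sum-zero (block-↑ˡ↑ʳ P _ E δ i)) ⟩
      sum (P i) + + 0                                             ≡⟨ ℤP.+-identityʳ (sum (P i)) ⟩
      sum (P i)                                                   ≡⟨ P-rowSum i ⟩
      δ zero i                                                    ≡⟨ δ-↑ˡ↑ˡ k zero i ⟨
      δ zero (old i)                                              ∎)
    (λ x → begin
      sum (P' (new x))                                            ≡⟨ sum-↑ {N} {k} (P' (new x)) ⟩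
      sum (λ l → P' (new x) (old l)) + sum (λ y → P' (new x) (new y))
                                                                  ≡⟨ cong₂ _+_ (sum-cong-≗ (block-↑ʳ↑ˡ P _ E δ x))
                                                                               (sum-cong-≗ (block-↑ʳ↑ʳ P _ E δ x)) ⟩
      sum (λ l → - δ c l) + sum (δ x)                             ≡⟨ cong₂ _+_ (trans (sum-neg (δ c)) (cong -_ (sum-δ c))) (sum-δ x) ⟩
      + 0                                                         ≡⟨ δ-↑ˡ↑ʳ {N} zero x ⟨
      δ zero (new x)                                              ∎)

  P'-·-old : ∀ {n} (X : Mat (N ℕ.+ k) n) i col → (P' · X) (old i) col ≡ sum (λ l → P i l * X (old l) col)
  P'-·-old = lowerBlock-·-↑ˡ P E

  P'-·-new : ∀ {n} (X : Mat (N ℕ.+ k) n) x col → (P' · X) (new x) col ≡ - X (old c) col + X (new x) col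
  P'-·-new X x col = trans (lowerBlock-·-↑ʳ P E X x col) (cong (_+ X (new x) col) (sum-neg-δ c (λ l → X (old l) col)))

  ·-P'ᵀ : ∀ {n} (X : Mat n (N ℕ.+ k)) r col → (X · P' ᵀ) r col ≡ (P' · X ᵀ) col r
  ·-P'ᵀ X r col = sum-cong-≗ (λ l → ℤP.*-comm (X r l) (P' col l))

  module _ (D : Fin (N ℕ.+ k) → Fin (N ℕ.+ k) → ℕ)
           (dist : ∀ a b → IsKDist k G (clique' a) (clique' b) (D a b)) where

    private
      dist' : ∀ {a b τ τ'} → clique' a ≡ τ → clique' b ≡ τ' → IsKDist k G τ τ' (D a b)
      dist' {a} {b} refl refl = dist a b

      clique'-c : clique' (old c) ≡ lift C
      clique'-c = trans (clique'-old c) (cong lift clique-c)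

    D-old : P · (toℤ (λ i j → D (old i) (old j)) · P ᵀ) ≐ canonical k s
    D-old = P·D·Pᵀ (λ i j → D (old i) (old j)) (λ i j → IsKDist-unlift (dist' (clique'-old i) (clique'-old j)))

    D-old-new : ∀ l y → D (old l) (new y) ≡ suc (D (old l) (old c))
    D-old-new l y = IsKDist-lift-ν (dist' (clique'-old l) (clique'-new y)) (dist' (clique'-old l) clique'-c)

    D-new-old : ∀ x l → D (new x) (old l) ≡ suc (D (old c) (old l))
    D-new-old x l = IsKDist-ν-lift (dist' (clique'-new x) (clique'-old l)) (dist' clique'-c (clique'-old l))

    D-c-c : D (old c) (old c) ≡ 0
    D-c-c = IsKDist-self (dist (old c) (old c))

    D-new-new : ∀ x y → + D (new x) (new y) ≡ + 1 - δ x y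
    D-new-new x y with x Fin.≟ y
    ... | yes refl = trans (cong +_ (IsKDist-self (dist (new x) (new x)))) (sym (cong (λ d → + 1 - d) (δ-refl x)))
    ... | no x≢y   = trans (cong +_ (IsKDist-ν-ν x≢y (dist' (clique'-new x) (clique'-new y))))
                           (sym (cong (λ d → + 1 - d) (δ-≢ x≢y)))

    W : Matrix (N ℕ.+ k)
    W = toℤ D · P' ᵀ

    W-old : ∀ r j → W r (old j) ≡ sum (λ m → + D r (old m) * P j m)
    W-old r j = begin
      W r (old j)                              ≡⟨ ·-P'ᵀ (toℤ D) r (old j) ⟩
      (P' · toℤ D ᵀ) (old j) r                 ≡⟨ P'-·-old (toℤ D ᵀ) j r ⟩
      sum (λ m → P j m * + D r (old m))        ≡⟨ sum-cong-≗ (λ m → ℤP.*-comm (P j m) (+ D r (old m))) ⟩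
      sum (λ m → + D r (old m) * P j m)        ∎

    W-new : ∀ r y → W r (new y) ≡ - + D r (old c) + + D r (new y)
    W-new r y = trans (·-P'ᵀ (toℤ D) r (new y)) (P'-·-new (toℤ D ᵀ) y r)

    M : Matrix (N ℕ.+ k)
    M = canonical k (suc s)

    private
      neg-+-suc : ∀ a → - + a + + suc a ≡ + 1
      neg-+-suc a = ring (+ a)
        where ring : ∀ x → - x + (+ 1 + x) ≡ + 1
              ring = solve-∀

    entry-old-old : ∀ i j → (P' · W) (old i) (old j) ≡ M (old i) (old j)
    entry-old-old i j = begin
      (P' · W) (old i) (old j)                  ≡⟨ P'-·-old W i (old j) ⟩
      sum (λ l → P i l * W (old l) (old j))     ≡⟨ sum-cong-≗ (λ l → cong (P i l *_) (W-old (old l) j)) ⟩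
      (P · (toℤ (λ i j → D (old i) (old j)) · P ᵀ)) i j
                                                ≡⟨ D-old i j ⟩
      canonical k s i j                         ≡⟨ block-↑ˡ↑ˡ (canonical k s) _ _ _ i j ⟨
      M (old i) (old j)                         ∎

    entry-old-new : ∀ i y → (P' · W) (old i) (new y) ≡ M (old i) (new y)
    entry-old-new i y = begin
      (P' · W) (old i) (new y)                  ≡⟨ P'-·-old W i (new y) ⟩
      sum (λ l → P i l * W (old l) (new y))     ≡⟨ sum-cong-≗ (λ l → cong (P i l *_) (trans (W-new (old l) y)
                                                     (trans (cong (λ d → - + D (old l) (old c) + + d) (D-old-new l y))
                                                            (neg-+-suc (D (old l) (old c)))))) ⟩
      sum (λ l → P i l * + 1)                   ≡⟨ sum-cong-≗ (λ l → ℤP.*-identityʳ (P i l)) ⟩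
      sum (P i)                                 ≡⟨ P-rowSum i ⟩
      δ zero i                                  ≡⟨ block-↑ˡ↑ʳ (canonical k s) _ _ _ i y ⟨
      M (old i) (new y)                         ∎

    entry-new-old : ∀ x j → (P' · W) (new x) (old j) ≡ M (new x) (old j)
    entry-new-old x j = begin
      (P' · W) (new x) (old j)                      ≡⟨ P'-·-new W x (old j) ⟩
      - W (old c) (old j) + W (new x) (old j)       ≡⟨ cong₂ (λ a b → - a + b) (W-old (old c) j) (W-old (new x) j) ⟩
      - S + sum (λ m → + D (new x) (old m) * P j m) ≡⟨ cong (λ z → - S + z) (trans (sum-cong-≗ (λ m →
                                                         trans (cong (λ d → + d * P j m) (D-new-old x m)) (suc-* (+ D (old c) (old m)) (P j m))))
                                                         (∑-distrib-+ (λ m → + D (old c) (old m) * P j m) (P j))) ⟩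
      - S + (S + sum (P j))                         ≡⟨ neg-cancel S (sum (P j)) ⟩
      sum (P j)                                     ≡⟨ P-rowSum j ⟩
      δ zero j                                      ≡⟨ block-↑ʳ↑ˡ (canonical k s) _ _ _ x j ⟨
      M (new x) (old j)                             ∎
      where
      S : ℤ
      S = sum (λ m → + D (old c) (old m) * P j m)
      suc-* : ∀ a q → (+ 1 + a) * q ≡ a * q + q
      suc-* = solve-∀
      neg-cancel : ∀ a b → - a + (a + b) ≡ b
      neg-cancel = solve-∀

    entry-new-new : ∀ x y → (P' · W) (new x) (new y) ≡ M (new x) (new y)
    entry-new-new x y = begin
      (P' · W) (new x) (new y)                      ≡⟨ P'-·-new W x (new y) ⟩
      - W (old c) (new y) + W (new x) (new y)       ≡⟨ cong₂ (λ a b → - a + b) (W-new (old c) y) (W-new (new x) y) ⟩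
      - (- + D (old c) (old c) + + D (old c) (new y)) + (- + D (new x) (old c) + + D (new x) (new y))
                                                    ≡⟨ cong₂ (λ a b → - (- + a + + b) + (- + D (new x) (old c) + + D (new x) (new y)))
                                                             D-c-c (trans (D-old-new c y) (cong suc D-c-c)) ⟩
      - (- + 0 + + 1) + (- + D (new x) (old c) + + D (new x) (new y))
                                                    ≡⟨ cong₂ (λ a b → - (- + 0 + + 1) + (- + a + b))
                                                             (trans (D-new-old x c) (cong suc D-c-c)) (D-new-new x y) ⟩
      - (- + 0 + + 1) + (- + 1 + (+ 1 - δ x y))     ≡⟨ ring (δ x y) ⟩
      - + 1 - δ x y                                 ≡⟨ block-↑ʳ↑ʳ (canonical k s) _ _ _ x y ⟨
      M (new x) (new y)                             ∎
      where
      ring : ∀ e → - (- + 0 + + 1) + (- + 1 + (+ 1 - e)) ≡ - + 1 - e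
      ring = solve-∀

    P'·D·P'ᵀ : P' · (toℤ D · P' ᵀ) ≐ M
    P'·D·P'ᵀ = ↑-elim _ (λ i → ↑-elim _ (entry-old-old i) (entry-old-new i))
                        (λ x → ↑-elim _ (entry-new-old x) (entry-new-new x))

  normalForm-step : NormalForm k G (suc s)
  normalForm-step = record
    { clique      = clique'
    ; enumeration = enumeration'
    ; P           = P'
    ; P⁻¹         = P'⁻¹
    ; P⁻¹·P       = P'⁻¹·P'
    ; P·P⁻¹       = P'·P'⁻¹
    ; P-rowSum    = P'-rowSum
    ; P·D·Pᵀ      = P'·D·P'ᵀ
    }

normalForm : ∀ {k m} {G : Graph m} → KTree k m G → ∃ λ s → m ≡ k ℕ.+ s × NormalForm k G s
normalForm {k} (base G complete) = 0 , sym (ℕP.+-identityʳ k) , normalForm-base complete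
normalForm {k} (step T C C-cl p G G-old G-newˡ G-newʳ _) with normalForm T
... | s , m≡k+s , NF = suc s , trans (cong suc m≡k+s) (sym (ℕP.+-suc k s)) ,
                       NormalFormStep.normalForm-step NF C C-cl p G-old G-newˡ G-newʳ

-- Congruence of integer matrices

-- U may be rectangular so that matrices indexed by different enumerations can be compared
-- before the enumerations are known to have the same size.
record _≅_ {a b} (A : Matrix a) (B : Matrix b) : Set where
  field
    U      : Mat a b
    U⁻¹    : Mat b a
    U·U⁻¹  : U · U⁻¹ ≐ δ
    U⁻¹·U  : U⁻¹ · U ≐ δ
    A≐UBUᵀ : A ≐ U · (B · U ᵀ)

·-inverse : ∀ {a b c} {X : Mat a b} {X' : Mat b a} {Y : Mat b c} {Y' : Mat c b} →
            X · X' ≐ δ → Y · Y' ≐ δ → (X · Y) · (Y' · X') ≐ δ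
·-inverse {X = X} {X'} {Y} {Y'} XX'≐δ YY'≐δ i j = begin
  ((X · Y) · (Y' · X')) i j  ≡⟨ ·-assoc X Y (Y' · X') i j ⟩
  (X · (Y · (Y' · X'))) i j  ≡⟨ ·-congˡ X (λ i j → sym (·-assoc Y Y' X' i j)) i j ⟩
  (X · ((Y · Y') · X')) i j  ≡⟨ ·-congˡ X (·-congʳ X' YY'≐δ) i j ⟩
  (X · (δ · X')) i j         ≡⟨ ·-congˡ X (·-identityˡ X') i j ⟩
  (X · X') i j               ≡⟨ XX'≐δ i j ⟩
  δ i j                      ∎

conjugate-cancel : ∀ {a b} {X : Mat a b} {X' : Mat b a} → X' · X ≐ δ → ∀ B → X' · ((X · (B · X ᵀ)) · X' ᵀ) ≐ B
conjugate-cancel {X = X} {X'} X'X≐δ B i j = begin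
  (X' · ((X · (B · X ᵀ)) · X' ᵀ)) i j  ≡⟨ ·-congˡ X' (·-assoc X (B · X ᵀ) (X' ᵀ)) i j ⟩
  (X' · (X · ((B · X ᵀ) · X' ᵀ))) i j  ≡⟨ ·-assoc X' X ((B · X ᵀ) · X' ᵀ) i j ⟨
  ((X' · X) · ((B · X ᵀ) · X' ᵀ)) i j  ≡⟨ ·-congʳ ((B · X ᵀ) · X' ᵀ) X'X≐δ i j ⟩
  (δ · ((B · X ᵀ) · X' ᵀ)) i j         ≡⟨ ·-identityˡ ((B · X ᵀ) · X' ᵀ) i j ⟩
  ((B · X ᵀ) · X' ᵀ) i j               ≡⟨ ·-assoc B (X ᵀ) (X' ᵀ) i j ⟩
  (B · (X ᵀ · X' ᵀ)) i j               ≡⟨ ·-congˡ B (ᵀ-inverse {A = X'} {X} X'X≐δ) i j ⟩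
  (B · δ) i j                          ≡⟨ ·-identityʳ B i j ⟩
  B i j                                ∎

≅-sym : ∀ {a b} {A : Matrix a} {B : Matrix b} → A ≅ B → B ≅ A
≅-sym {A = A} {B} A≅B = record
  { U      = U⁻¹
  ; U⁻¹    = U
  ; U·U⁻¹  = U⁻¹·U
  ; U⁻¹·U  = U·U⁻¹
  ; A≐UBUᵀ = λ i j → sym (trans (·-congˡ U⁻¹ (·-congʳ (U⁻¹ ᵀ) A≐UBUᵀ) i j)
                                (conjugate-cancel {X = U} {U⁻¹} U⁻¹·U B i j))
  }
  where open _≅_ A≅B

module _ {a b c : ℕ} where

  ≅-trans : {A : Matrix a} {B : Matrix b} {C : Matrix c} → A ≅ B → B ≅ C → A ≅ C
  ≅-trans {A} {B} {C} A≅B B≅C = record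
    { U      = U₁ · U₂
    ; U⁻¹    = U₂⁻¹ · U₁⁻¹
    ; U·U⁻¹  = ·-inverse {X = U₁} {U₁⁻¹} {U₂} {U₂⁻¹} U₁·U₁⁻¹ U₂·U₂⁻¹
    ; U⁻¹·U  = ·-inverse {X = U₂⁻¹} {U₂} {U₁⁻¹} {U₁} U₂⁻¹·U₂ U₁⁻¹·U₁
    ; A≐UBUᵀ = λ i j → begin
        A i j                                  ≡⟨ A≐U₁BU₁ᵀ i j ⟩
        (U₁ · (B · U₁ ᵀ)) i j                  ≡⟨ ·-congˡ U₁ (·-congʳ (U₁ ᵀ) B≐U₂CU₂ᵀ) i j ⟩
        (U₁ · ((U₂ · (C · U₂ ᵀ)) · U₁ ᵀ)) i j  ≡⟨ ·-congˡ U₁ (·-assoc U₂ (C · U₂ ᵀ) (U₁ ᵀ)) i j ⟩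
        (U₁ · (U₂ · ((C · U₂ ᵀ) · U₁ ᵀ))) i j  ≡⟨ ·-assoc U₁ U₂ ((C · U₂ ᵀ) · U₁ ᵀ) i j ⟨
        ((U₁ · U₂) · ((C · U₂ ᵀ) · U₁ ᵀ)) i j  ≡⟨ ·-congˡ (U₁ · U₂) (·-assoc C (U₂ ᵀ) (U₁ ᵀ)) i j ⟩
        ((U₁ · U₂) · (C · (U₂ ᵀ · U₁ ᵀ))) i j  ≡⟨ ·-congˡ (U₁ · U₂) (·-congˡ C (λ i j → sym (ᵀ-· U₁ U₂ i j))) i j ⟩
        ((U₁ · U₂) · (C · (U₁ · U₂) ᵀ)) i j    ∎
    }
    where
    open _≅_ A≅B renaming (U to U₁; U⁻¹ to U₁⁻¹; U·U⁻¹ to U₁·U₁⁻¹; U⁻¹·U to U₁⁻¹·U₁; A≐UBUᵀ to A≐U₁BU₁ᵀ)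
    open _≅_ B≅C renaming (U to U₂; U⁻¹ to U₂⁻¹; U·U⁻¹ to U₂·U₂⁻¹; U⁻¹·U to U₂⁻¹·U₂; A≐UBUᵀ to B≐U₂CU₂ᵀ)

≅-reindex : ∀ {a b} (π : Fin a → Fin b) (ρ : Fin b → Fin a) → (∀ i → ρ (π i) ≡ i) → (∀ x → π (ρ x) ≡ x) →
            ∀ (A : Matrix a) → A ≅ (λ x y → A (ρ x) (ρ y))
≅-reindex {a} {b} π ρ ρπ πρ A = record
  { U      = Π
  ; U⁻¹    = Π ᵀ
  ; U·U⁻¹  = λ i j → trans (sum-δˡ (π i) (δ (π j))) (trans (δ-π j (π i)) (trans (cong (δ j) (ρπ i)) (δ-sym j i)))
  ; U⁻¹·U  = λ x y → trans (sum-Π x (λ i → δ (π i) y)) (cong (λ z → δ z y) (πρ x))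
  ; A≐UBUᵀ = λ i j → sym (begin
      sum (λ x → δ (π i) x * sum (λ y → A (ρ x) (ρ y) * δ (π j) y))  ≡⟨ sum-cong-≗ (λ x → cong (δ (π i) x *_)
                                                                           (trans (sum-cong-≗ (λ y → cong (A (ρ x) (ρ y) *_) (δ-sym (π j) y)))
                                                                                  (sum-δʳ (π j) (λ y → A (ρ x) (ρ y))))) ⟩
      sum (λ x → δ (π i) x * A (ρ x) (ρ (π j)))                      ≡⟨ sum-δˡ (π i) (λ x → A (ρ x) (ρ (π j))) ⟩
      A (ρ (π i)) (ρ (π j))                                          ≡⟨ cong₂ A (ρπ i) (ρπ j) ⟩
      A i j                                                          ∎)
  }
  where
  Π : Mat a b
  Π i x = δ (π i) x
  δ-π : ∀ i x → δ (π i) x ≡ δ i (ρ x)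
  δ-π i x with i Fin.≟ ρ x
  ... | yes refl = trans (cong (λ z → δ z x) (πρ x)) (trans (δ-refl x) (sym (δ-refl (ρ x))))
  ... | no i≢ρx  = trans (δ-≢ (λ πi≡x → i≢ρx (trans (sym (ρπ i)) (cong ρ πi≡x)))) (sym (δ-≢ i≢ρx))
  sum-Π : ∀ x (f : Fin a → ℤ) → sum (λ i → δ (π i) x * f i) ≡ f (ρ x)
  sum-Π x f = trans (sum-cong-≗ (λ i → cong (_* f i) (trans (δ-π i x) (δ-sym i (ρ x))))) (sum-δˡ (ρ x) f)

≅-congruent : ∀ {a} {P P⁻¹ A B : Matrix a} → P⁻¹ · P ≐ δ → P · P⁻¹ ≐ δ → P · (A · P ᵀ) ≐ B → A ≅ B
≅-congruent {P = P} {P⁻¹} P⁻¹·P P·P⁻¹ PAPᵀ≐B = ≅-sym (record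
  { U = P ; U⁻¹ = P⁻¹ ; U·U⁻¹ = P·P⁻¹ ; U⁻¹·U = P⁻¹·P ; A≐UBUᵀ = λ i j → sym (PAPᵀ≐B i j) })

⊗≐· : ∀ {c} (A B : Matrix c) → A ⊗ B ≐ A · B
⊗≐· A B i j = sumFin≡sum (λ l → A i l * B l j)

≅⇒unimodular-equivalent : ∀ {c} {A B : Matrix c} → A ≅ B →
  ∃₂ λ (P Q : Matrix c) → Unimodular P × Unimodular Q × (∀ i j → A i j ≡ (P ⊗ (B ⊗ Q)) i j)
≅⇒unimodular-equivalent {B = B} A≅B =
  U , U ᵀ , rightInverse⇒unimodular U·U⁻¹ , rightInverse⇒unimodular (ᵀ-inverse {A = U⁻¹} {U} U⁻¹·U) , λ i j → begin
    _                      ≡⟨ A≐UBUᵀ i j ⟩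
    (U · (B · U ᵀ)) i j    ≡⟨ ·-congˡ U (⊗≐· B (U ᵀ)) i j ⟨
    (U · (B ⊗ (U ᵀ))) i j    ≡⟨ ⊗≐· U (B ⊗ (U ᵀ)) i j ⟨
    (U ⊗ (B ⊗ (U ᵀ))) i j    ∎
  where open _≅_ A≅B

kDistance-≅-normalForm : ∀ {k n s c} {G : Graph n} {e : Fin c → Subset n} {D : Fin c → Fin c → ℕ} →
                         NormalForm k G s → IsKCliqueEnumeration k G c e → (∀ i j → IsKDist k G (e i) (e j) (D i j)) →
                         toℤ D ≅ canonical k s
kDistance-≅-normalForm {k} {G = G} {e} {D} NF (e-isKClique , e-injective , e-surjective) dist =
  ≅-trans (≅-reindex π ρ ρπ πρ (toℤ D))
          (≅-congruent {P = P} {P⁻¹} P⁻¹·P P·P⁻¹ (P·D·Pᵀ (λ x y → D (ρ x) (ρ y)) dist-ρ))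
  where
  open NormalForm NF
  π : Fin _ → Fin _
  π i = proj₁ (proj₂ (proj₂ enumeration) (e i) (e-isKClique i))
  ρ : Fin _ → Fin _
  ρ x = proj₁ (e-surjective (clique x) (proj₁ enumeration x))
  clique∘π : ∀ i → clique (π i) ≡ e i
  clique∘π i = proj₂ (proj₂ (proj₂ enumeration) (e i) (e-isKClique i))
  e∘ρ : ∀ x → e (ρ x) ≡ clique x
  e∘ρ x = proj₂ (e-surjective (clique x) (proj₁ enumeration x))
  ρπ : ∀ i → ρ (π i) ≡ i
  ρπ i = e-injective (ρ (π i)) i (trans (e∘ρ (π i)) (clique∘π i))
  πρ : ∀ x → π (ρ x) ≡ x
  πρ x = proj₁ (proj₂ enumeration) (π (ρ x)) x (trans (clique∘π (ρ x)) (e∘ρ x))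
  dist-ρ : ∀ x y → IsKDist k G (clique x) (clique y) (D (ρ x) (ρ y))
  dist-ρ x y = subst₂ (λ τ τ' → IsKDist k G τ τ' (D (ρ x) (ρ y))) (e∘ρ x) (e∘ρ y) (dist (ρ x) (ρ y))

kDistance-≅-canonical : ∀ {k n c} {G : Graph n} {e : Fin c → Subset n} {D : Fin c → Fin c → ℕ} →
                        KTree k n G → IsKCliqueEnumeration k G c e → (∀ i j → IsKDist k G (e i) (e j) (D i j)) →
                        toℤ D ≅ canonical k (n ℕ.∸ k)
kDistance-≅-canonical {k} {D = D} T E dist with normalForm T
... | s , refl , NF = subst (λ s → toℤ D ≅ canonical k s) (sym (ℕP.m+n∸m≡n k s)) (kDistance-≅-normalForm NF E dist)

mainTheorem2 : (k n : ℕ) → 1 ℕ.≤ k → k ℕ.+ 2 ℕ.≤ n →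
    (G G' : Graph n) → KTree k n G → KTree k n G' →
    (c : ℕ) (e e' : Fin c → Subset n) →
    IsKCliqueEnumeration k G c e → IsKCliqueEnumeration k G' c e' →
    (D D' : Fin c → Fin c → ℕ) →
    (∀ i j → IsKDist k G (e i) (e j) (D i j)) →
    (∀ i j → IsKDist k G' (e' i) (e' j) (D' i j)) →
    ∃₂ λ (P Q : Matrix c) → Unimodular P × Unimodular Q ×
    (∀ i j → + D i j ≡ (P ⊗ ((λ a b → + D' a b) ⊗ Q)) i j)
mainTheorem2 k n _ _ G G' T T' c e e' E E' D D' dist dist' =
  ≅⇒unimodular-equivalent (≅-trans (kDistance-≅-canonical T E dist) (≅-sym (kDistance-≅-canonical T' E' dist')))
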